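{- Every recurrent finite abelian processor can be emulated by a finite, directed acyclic abelian network whose nodes are adders, splitters and topplers.
   Context: $\mathbb{N}=\{0,1,2,\dots\}$. A processor with finite input alphabet $A$, finite output alphabet $B$ and finite state space $Q$ consists of transition maps $t_i:Q\to Q$ and output maps $o_i:Q\to\mathbb{N}^B$ ($i\in A$): on receiving letter $i$ in state $q$ it moves to $t_i(q)$ and emits $(o_i(q))_b$ copies of letter $b$. It is abelian if $t_it_j=t_jt_i$ and $o_i+o_j\circ t_i=o_j+o_i\circ t_j$ for all $i,j$. Every processor has an initial state $q^0$ from which every state is reachable by compositions of transition maps. It computes $F:\mathbb{N}^A\to\mathbb{N}^B$, where $F(\mathbf{x})$ is the total output when, from $q^0$, it receives $x_a$ letters $a$ for each $a$ (order-independent). It is recurrent if for every pair of states $q,q'$ some finite sequence of input letters takes it from $q$ to $q'$. An abelian network is a finite directed multigraph with pairwise disjoint sets of dangling input edges (no tail), output edges and trash edges (no head); each node carries a finite abelian processor (with an initial state) whose input alphabet is its set of incoming edges and output alphabet its set of outgoing edges. Given letters on input edges, the network repeatedly picks any non-output, non-trash edge carrying a letter and feeds one letter to the processor at its head, which changes state and places emitted letters on its outgoing edges; it halts when all letters lie on output or trash edges. Halting and output are independent of the choices; a network halting on all inputs computes a function and emulates a processor if it computes the same function. It is directed acyclic if its graph has no directed cycle. Gates: an adder (one state, two inputs, one output, computes $(x,y)\mapsto x+y$); a splitter (one state, one input, two outputs, computes $x\mapsto (x,x)$); for an integer $\lambda\ge2$, a $\lambda$-toppler with one input, one output and states $0,\dots,\lambda-1$: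 a letter received in state $q<\lambda-1$ moves it to $q+1$ emitting nothing, a letter received in state $\lambda-1$ moves it to $0$ emitting one letter; started in state $q$ it computes $x\mapsto\lfloor (x+q)/\lambda\rfloor$ (topplers may start in any state; a toppler started in a nonzero state is called primed). -}

module Defs where

open import Data.Nat using (ℕ; zero; suc; _+_; _∸_; _≤_; _<_; _<ᵇ_)
open import Data.Fin using (Fin; _≟_)
import Data.Fin as Fin
open import Data.Bool using (Bool; true; false; if_then_else_)
open import Data.Maybe using (Maybe; just; nothing)
open import Data.List using (List; []; _∷_; concatMap; replicate; allFin)
open import Data.Product using (Σ; ∃; _×_; _,_)
open import Relation.Nullary using (does)
open import Data.Empty using (⊥)
open import Relation.Binary.PropositionalEquality using (_≡_)

record Processor (nA nB : ℕ) : Set where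
  field
    nQ : ℕ
    t  : Fin nA → Fin nQ → Fin nQ
    o  : Fin nA → Fin nQ → Fin nB → ℕ
    q0 : Fin nQ

module _ {nA nB : ℕ} (P : Processor nA nB) where
  open Processor P

  runState : Fin nQ → List (Fin nA) → Fin nQ
  runState q []      = q
  runState q (i ∷ w) = runState (t i q) w

  runOut : Fin nQ → List (Fin nA) → Fin nB → ℕ
  runOut q []      b = 0
  runOut q (i ∷ w) b = o i q b + runOut (t i q) w b

  IsAbelian : Set
  IsAbelian =
    (∀ i j q → t i (t j q) ≡ t j (t i q)) ×
    (∀ i j q b → o i q b + o j (t i q) b ≡ o j q b + o i (t j q) b)

  AllReachable : Set
  AllReachable = ∀ q → ∃ λ w → runState q0 w ≡ q

  IsRecurrent : Set
  IsRecurrent = ∀ q q' → ∃ λ w → runState q w ≡ q'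

  inputWord : (Fin nA → ℕ) → List (Fin nA)
  inputWord x = concatMap (λ a → replicate (x a) a) (allFin nA)

  compute : (Fin nA → ℕ) → Fin nB → ℕ
  compute x = runOut q0 (inputWord x)

data Gate : Set where
  adder    : Gate
  splitter : Gate
  toppler  : (lam : ℕ) → 2 ≤ lam → (q : ℕ) → q < lam → Gate

inArity : Gate → ℕ
inArity adder               = 2
inArity splitter            = 1
inArity (toppler _ _ _ _)   = 1

outArity : Gate → ℕ
outArity adder              = 1
outArity splitter           = 2
outArity (toppler _ _ _ _)  = 1

initState : Gate → ℕ
initState adder             = 0
initState splitter          = 0
initState (toppler _ _ q _) = q

-- on receiving a letter in state s: (new state , emits one letter on each
-- outgoing edge?)   (adders and splitters have a single state 0)
gateStep : Gate → ℕ → ℕ × Bool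
gateStep adder s = s , true
gateStep splitter s = s , true
gateStep (toppler lam _ _ _) s = if suc s <ᵇ lam then (suc s , false) else (0 , true)

-- Finite networks of gates.
-- Input edges are indexed by A = Fin nA (no tail, head a node),
-- output edges by B = Fin nB (no head), trash edges (no head),
-- internal edges (tail and head nodes).

record Network (nA nB : ℕ) : Set where
  field
    nodes     : ℕ
    gate      : Fin nodes → Gate
    nInt      : ℕ
    nTrash    : ℕ
    inHead    : Fin nA → Fin nodes
    intTail   : Fin nInt → Fin nodes
    intHead   : Fin nInt → Fin nodes
    outTail   : Fin nB → Maybe (Fin nodes)   -- nothing: edge attached to no node
    trashTail : Fin nTrash → Fin nodes

count : ∀ {n} → (Fin n → Bool) → ℕ
count {zero}  p = 0
count {suc n} p = (if p Fin.zero then 1 else 0) + count (λ i → p (Fin.suc i))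

_==_ : ∀ {n} → Fin n → Fin n → Bool
i == j = does (i ≟ j)

atNode : ∀ {n} → Maybe (Fin n) → Fin n → Bool
atNode nothing  v = false
atNode (just u) v = u == v

module NetSem {nA nB : ℕ} (N : Network nA nB) where
  open Network N

  indegree : Fin nodes → ℕ
  indegree v = count (λ a → inHead a == v) + count (λ e → intHead e == v)

  outdegree : Fin nodes → ℕ
  outdegree v = count (λ e → intTail e == v) + count (λ b → atNode (outTail b) v)
                + count (λ e → trashTail e == v)

  WellFormed : Set
  WellFormed = ∀ v → (indegree v ≡ inArity (gate v)) × (outdegree v ≡ outArity (gate v))

  data Path⁺ : Fin nodes → Fin nodes → Set where
    edge : (e : Fin nInt) → Path⁺ (intTail e) (intHead e)
    step : ∀ {w} (e : Fin nInt) → Path⁺ (intHead e) w → Path⁺ (intTail e) w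

  Acyclic : Set
  Acyclic = ∀ v → Path⁺ v v → ⊥

  record Config : Set where
    field
      inCnt    : Fin nA → ℕ
      intCnt   : Fin nInt → ℕ
      outCnt   : Fin nB → ℕ
      trashCnt : Fin nTrash → ℕ
      st       : Fin nodes → ℕ
  open Config

  initConfig : (Fin nA → ℕ) → Config
  initConfig x = record
    { inCnt = x ; intCnt = λ _ → 0 ; outCnt = λ _ → 0 ; trashCnt = λ _ → 0
    ; st = λ v → initState (gate v) }

  dec : ∀ {n} → Fin n → (Fin n → ℕ) → Fin n → ℕ
  dec i f j = if i == j then f j ∸ 1 else f j

  set : ∀ {n} → Fin n → ℕ → (Fin n → ℕ) → Fin n → ℕ
  set i s f j = if i == j then s else f j

  addIf : ∀ {n} → (Fin n → Bool) → (Fin n → ℕ) → Fin n → ℕ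
  addIf p f j = if p j then suc (f j) else f j

  -- node v processes one letter (already removed from its edge)
  process : Config → Fin nodes → Config
  process c v with gateStep (gate v) (st c v)
  ... | s' , false = record c { st = set v s' (st c) }
  ... | s' , true  = record c
    { st       = set v s' (st c)
    ; intCnt   = addIf (λ e → intTail e == v) (intCnt c)
    ; outCnt   = addIf (λ b → atNode (outTail b) v) (outCnt c)
    ; trashCnt = addIf (λ e → trashTail e == v) (trashCnt c) }

  data Run : Config → Config → Set where
    done     : ∀ {c} → Run c c
    fromIn   : ∀ {c c'} (a : Fin nA) → 0 < inCnt c a →
               Run (process (record c { inCnt = dec a (inCnt c) }) (inHead a)) c' → Run c c'
    fromInt  : ∀ {c c'} (e : Fin nInt) → 0 < intCnt c e →
               Run (process (record c { intCnt = dec e (intCnt c) }) (intHead e)) c' → Run c c'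

  Halted : Config → Set
  Halted c = (∀ a → inCnt c a ≡ 0) × (∀ e → intCnt c e ≡ 0)

  HaltsWith : (Fin nA → ℕ) → (Fin nB → ℕ) → Set
  HaltsWith x y = Σ Config λ c → Run (initConfig x) c × Halted c × (∀ b → outCnt c b ≡ y b)

WellFormed : ∀ {nA nB} → Network nA nB → Set
WellFormed N = NetSem.WellFormed N

Acyclic : ∀ {nA nB} → Network nA nB → Set
Acyclic N = NetSem.Acyclic N

Emulates : ∀ {nA nB} → Network nA nB → Processor nA nB → Set
Emulates N P = ∀ x → NetSem.HaltsWith N x (compute P x)

module Submission where

open import Data.Nat using (ℕ; pred; _!)
open import Data.Maybe using (Maybe)
open import Data.Product using (Σ; _×_; _,_; proj₁; proj₂)
open import Function using (_∘_)
open import Relation.Binary.PropositionalEquality using (_≡_; trans)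
open import Defs

-- Let F = compute P. Every state of a recurrent processor lies on a cycle of each t_i, of length
-- at most nQ, so nQ! letters i lead every state back to itself; for an abelian processor this
-- makes F monotone and periodic: adding nQ! to x_i adds a constant c_i to F x. Also F 0 = 0.
--
-- Such an F is a floor sum. In one variable, Hermite's identity ∑_{j<c} ⌊(g + j)/c⌋ = g gives
--   G y = ∑_{j<c} ⌊(y + S_j)/m⌋   with   S_j = ∑_{r<m} ⌊(G r + j)/c⌋
-- for G monotone with G (y + m) = G y + c. Taking y = x₀ and the other inputs fixed, the S_j are
-- floor sums of the slices F (r, ·), which have one input fewer. Constants inside floors become
-- initial states of primed topplers, and the one left over is F 0 = 0.
--
-- A floor sum is computed by a tree of adders and topplers whose inputs are copied by splitters.
-- Its nodes can be numbered so that every edge goes up, and then the numbers L v of letters each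
-- node processes are the unique solution of the balance equations at the nodes. Any run that
-- feeds letters while some are pending keeps these counts below L, so it stops, and it stops
-- exactly at L, with the output F x.

module Arithmetic where

  open import Data.Nat using (ℕ; zero; suc; _+_; _*_; _≤_; _<_; z≤n; NonZero)
  open import Data.Nat.Properties
  open import Data.Nat.DivMod
  open import Data.Nat.Divisibility using (n∣m*n)
  open import Data.Fin using (Fin; zero; suc; toℕ)
  open import Data.Fin.Properties using (toℕ<n)
  open import Data.Sum using (inj₁; inj₂)
  open import Function using (_∘_)
  open import Relation.Binary.PropositionalEquality
  open import Algebra.Properties.CommutativeMonoid.Sum +-0-commutativeMonoid
    using (sum; sum-syntax; sum-cong-≗; sum-replicate-zero)
  open import Algebra.Properties.CommutativeSemigroup +-commutativeSemigroup
    using (xy∙z≈zx∙y; xy∙z≈xz∙y)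

  sum-const : ∀ n k → ∑[ i < n ] k ≡ n * k
  sum-const zero    k = refl
  sum-const (suc n) k = cong (k +_) (sum-const n k)

  sum-mono-≤ : ∀ {n} {f g : Fin n → ℕ} → (∀ i → f i ≤ g i) → sum f ≤ sum g
  sum-mono-≤ {zero}  f≤g = z≤n
  sum-mono-≤ {suc n} f≤g = +-mono-≤ (f≤g zero) (sum-mono-≤ (f≤g ∘ suc))

  sum-mono-< : ∀ {n} {f g : Fin n → ℕ} i → (∀ j → f j ≤ g j) → f i < g i → sum f < sum g
  sum-mono-< zero    f≤g fi<gi = +-mono-<-≤ fi<gi (sum-mono-≤ (f≤g ∘ suc))
  sum-mono-< (suc i) f≤g fi<gi = +-mono-≤-< (f≤g zero) (sum-mono-< i (f≤g ∘ suc) fi<gi)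

  sum-shift : ∀ n (f : ℕ → ℕ) → ∑[ j < n ] f (suc (toℕ j)) + f 0 ≡ ∑[ j < n ] f (toℕ j) + f n
  sum-shift zero    f = refl
  sum-shift (suc n) f = begin
    f 1 + ∑[ j < n ] f (2 + toℕ j) + f 0       ≡⟨ cong (_+ f 0) (+-comm (f 1) _) ⟩
    ∑[ j < n ] f (2 + toℕ j) + f 1 + f 0       ≡⟨ cong (_+ f 0) (sum-shift n (f ∘ suc)) ⟩
    ∑[ j < n ] f (1 + toℕ j) + f (suc n) + f 0 ≡⟨ xy∙z≈zx∙y _ _ (f 0) ⟩
    f 0 + ∑[ j < n ] f (1 + toℕ j) + f (suc n) ∎
    where open ≡-Reasoning

  step-mono⇒mono : (G : ℕ → ℕ) → (∀ y → G y ≤ G (suc y)) → ∀ {a b} → a ≤ b → G a ≤ G b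
  step-mono⇒mono G step {b = zero}  z≤n = ≤-refl
  step-mono⇒mono G step {b = suc b} a≤1+b with m≤n⇒m<n∨m≡n a≤1+b
  ... | inj₁ a<1+b = ≤-trans (step-mono⇒mono G step (≤-pred a<1+b)) (step b)
  ... | inj₂ refl  = ≤-refl

  [m+kn]/n≡m/n+k : ∀ m k n .{{_ : NonZero n}} → (m + k * n) / n ≡ m / n + k
  [m+kn]/n≡m/n+k m k n = trans (+-distrib-/-∣ʳ m (n∣m*n k)) (cong (m / n +_) (m*n/n≡m k n))

  [m+n]/n≡1+m/n : ∀ m n .{{_ : NonZero n}} → (m + n) / n ≡ suc (m / n)
  [m+n]/n≡1+m/n m n = trans (cong (λ k → (m + k) / n) (sym (+-identityʳ n)))
                        (trans ([m+kn]/n≡m/n+k m 1 n) (+-comm (m / n) 1))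

  [m+n+o]/n≡1+[m+o]/n : ∀ m n o .{{_ : NonZero n}} → (m + n + o) / n ≡ suc ((m + o) / n)
  [m+n+o]/n≡1+[m+o]/n m n o = trans (cong (_/ n) (xy∙z≈xz∙y m n o)) ([m+n]/n≡1+m/n (m + o) n)

  /-unique : ∀ {m q} n .{{_ : NonZero n}} → q * n ≤ m → m < suc q * n → m / n ≡ q
  /-unique {m} {q} n lo hi = ≤-antisym (≤-pred (m<n*o⇒m/o<n hi))
    (subst (_≤ m / n) (m*n/n≡m q n) (/-monoˡ-≤ n lo))

  hermite : ∀ c .{{_ : NonZero c}} g → ∑[ j < c ] ((g + toℕ j) / c) ≡ g
  hermite c zero    = trans (sum-cong-≗ {c} (λ j → m<n⇒m/n≡0 (toℕ<n j))) (sum-replicate-zero c)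
  hermite c (suc g) = +-cancelʳ-≡ (g / c) _ _ (begin
    ∑[ j < c ] ((suc g + toℕ j) / c) + g / c  ≡⟨ cong₂ _+_ (sum-cong-≗ {c} (λ j → cong (_/ c) (sym (+-suc g (toℕ j)))))
                                                           (cong (_/ c) (sym (+-identityʳ g))) ⟩
    ∑[ j < c ] f (suc (toℕ j)) + f 0          ≡⟨ sum-shift c f ⟩
    ∑[ j < c ] f (toℕ j) + f c                ≡⟨ cong₂ _+_ (hermite c g) ([m+n]/n≡1+m/n g c) ⟩
    g + suc (g / c)                           ≡⟨ +-suc g (g / c) ⟩
    suc g + g / c                             ∎)
    where
    open ≡-Reasoning
    f : ℕ → ℕ
    f j = (g + j) / c

  floorSum : (m c : ℕ) .{{_ : NonZero c}} → (ℕ → ℕ) → ℕ → ℕ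
  floorSum m c G j = ∑[ r < m ] ((G (toℕ r) + j) / c)

  floorSum-suc : ∀ m c .{{_ : NonZero c}} (G : ℕ → ℕ) → G m ≡ G 0 + c →
                 ∀ j → floorSum m c (G ∘ suc) j ≡ suc (floorSum m c G j)
  floorSum-suc m c G period j = +-cancelʳ-≡ (T 0) _ _ (begin
    floorSum m c (G ∘ suc) j + T 0        ≡⟨ sum-shift m T ⟩
    floorSum m c G j + T m                ≡⟨ cong (λ k → floorSum m c G j + (k + j) / c) period ⟩
    floorSum m c G j + (G 0 + c + j) / c  ≡⟨ cong (floorSum m c G j +_) ([m+n+o]/n≡1+[m+o]/n (G 0) c j) ⟩
    floorSum m c G j + suc (T 0)          ≡⟨ +-suc _ (T 0) ⟩
    suc (floorSum m c G j) + T 0          ∎)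
    where
    open ≡-Reasoning
    T : ℕ → ℕ
    T r = (G r + j) / c

  -- every summand lies between ⌊(G 0 + j)/c⌋ and one more, and the first one is the lower bound
  floorSum/m : ∀ m c .{{_ : NonZero c}} (G : ℕ → ℕ) → (∀ y → G y ≤ G (suc y)) → G (suc m) ≡ G 0 + c →
               ∀ j → floorSum (suc m) c G j / suc m ≡ (G 0 + j) / c
  floorSum/m m c G step period j = /-unique (suc m) lower upper
    where
    u : ℕ
    u = (G 0 + j) / c
    T : Fin (suc m) → ℕ
    T r = (G (toℕ r) + j) / c
    u≤T : ∀ r → u ≤ T r
    u≤T r = /-monoˡ-≤ c (+-monoˡ-≤ j (step-mono⇒mono G step z≤n))
    T≤1+u : ∀ r → T r ≤ suc u
    T≤1+u r = begin
      (G (toℕ r) + j) / c  ≤⟨ /-monoˡ-≤ c (+-monoˡ-≤ j (step-mono⇒mono G step (<⇒≤ (toℕ<n r)))) ⟩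
      (G (suc m) + j) / c  ≡⟨ cong (λ k → (k + j) / c) period ⟩
      (G 0 + c + j) / c    ≡⟨ [m+n+o]/n≡1+[m+o]/n (G 0) c j ⟩
      suc u                ∎
      where open ≤-Reasoning
    lower : u * suc m ≤ floorSum (suc m) c G j
    lower = subst (_≤ floorSum (suc m) c G j) (trans (sum-const (suc m) u) (*-comm (suc m) u)) (sum-mono-≤ u≤T)
    upper : floorSum (suc m) c G j < suc u * suc m
    upper = <-≤-trans (sum-mono-< zero T≤1+u (n<1+n u))
                      (≤-reflexive (trans (sum-const (suc m) (suc u)) (*-comm (suc m) (suc u))))

  floorSum-representation : ∀ m c .{{_ : NonZero c}} (G : ℕ → ℕ) →
    (∀ y → G y ≤ G (suc y)) → (∀ y → G (y + suc m) ≡ G y + c) →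
    ∀ y → G y ≡ ∑[ j < c ] ((y + floorSum (suc m) c G (toℕ j)) / suc m)
  floorSum-representation m c G step period zero = sym (begin
    ∑[ j < c ] (floorSum (suc m) c G (toℕ j) / suc m)  ≡⟨ sum-cong-≗ {c} (floorSum/m m c G step (period 0) ∘ toℕ) ⟩
    ∑[ j < c ] ((G 0 + toℕ j) / c)                    ≡⟨ hermite c (G 0) ⟩
    G 0                                               ∎)
    where open ≡-Reasoning
  floorSum-representation m c G step period (suc y) = begin
    G (suc y)
      ≡⟨ floorSum-representation m c (G ∘ suc) (step ∘ suc) (period ∘ suc) y ⟩
    ∑[ j < c ] ((y + floorSum (suc m) c (G ∘ suc) (toℕ j)) / suc m)
      ≡⟨ sum-cong-≗ {c} (λ j → cong (_/ suc m) (shifted (toℕ j))) ⟩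
    ∑[ j < c ] ((suc y + floorSum (suc m) c G (toℕ j)) / suc m) ∎
    where
    open ≡-Reasoning
    shifted : ∀ j → y + floorSum (suc m) c (G ∘ suc) j ≡ suc y + floorSum (suc m) c G j
    shifted j = trans (cong (y +_) (floorSum-suc (suc m) c G (period 0) j)) (+-suc y _)

  periodic-zero⇒const : ∀ m (G : ℕ → ℕ) → (∀ y → G y ≤ G (suc y)) → (∀ y → G (y + suc m) ≡ G y + 0) →
                        ∀ y → G y ≡ G 0
  periodic-zero⇒const m G step period y =
    ≤-antisym (≤-trans (step-mono⇒mono G step y≤y*[1+m]) (≤-reflexive (multiples y)))
              (step-mono⇒mono G step z≤n)
    where
    multiples : ∀ k → G (k * suc m) ≡ G 0
    multiples zero    = refl
    multiples (suc k) = trans (cong G (+-comm (suc m) (k * suc m)))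
                          (trans (period (k * suc m)) (trans (+-identityʳ _) (multiples k)))
    y≤y*[1+m] : y ≤ y * suc m
    y≤y*[1+m] = m≤m*n y (suc m)

module Circuits where

  open import Data.Nat using (ℕ; zero; suc; _+_; _*_; _≤_; _<_)
  open import Data.Nat.Properties
  open import Data.Nat.DivMod
  open import Data.Fin using (Fin; zero; suc; toℕ)
  open import Data.Maybe using (Maybe; just; nothing)
  import Data.Maybe as Maybe
  open import Data.Product using (Σ; _×_; _,_; proj₁; proj₂)
  open import Data.Vec.Functional using (_∷_; updateAt)
  open import Function using (_∘_)
  open import Relation.Binary.PropositionalEquality
  open import Algebra.Properties.CommutativeMonoid.Sum +-0-commutativeMonoid
    using (sum-syntax; sum-cong-≗)
  open import Algebra.Properties.CommutativeSemigroup +-commutativeSemigroup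
    using (interchange)
  open Arithmetic

  data Circuit (n : ℕ) : Set where
    input  : Fin n → Circuit n
    _⊕_    : Circuit n → Circuit n → Circuit n
    topple : (d q : ℕ) → q < 2 + d → Circuit n → Circuit n

  ⟦_⟧ : ∀ {n} → Circuit n → (Fin n → ℕ) → ℕ
  ⟦ input i        ⟧ x = x i
  ⟦ a ⊕ b          ⟧ x = ⟦ a ⟧ x + ⟦ b ⟧ x
  ⟦ topple d q _ a ⟧ x = (⟦ a ⟧ x + q) / (2 + d)

  rename : ∀ {n k} → (Fin n → Fin k) → Circuit n → Circuit k
  rename ρ (input i)         = input (ρ i)
  rename ρ (a ⊕ b)           = rename ρ a ⊕ rename ρ b
  rename ρ (topple d q q< a) = topple d q q< (rename ρ a)

  ⟦rename⟧ : ∀ {n k} (ρ : Fin n → Fin k) a x → ⟦ rename ρ a ⟧ x ≡ ⟦ a ⟧ (x ∘ ρ)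
  ⟦rename⟧ ρ (input i)        x = refl
  ⟦rename⟧ ρ (a ⊕ b)          x = cong₂ _+_ (⟦rename⟧ ρ a x) (⟦rename⟧ ρ b x)
  ⟦rename⟧ ρ (topple d q _ a) x = cong (λ k → (k + q) / (2 + d)) (⟦rename⟧ ρ a x)

  ⟦⟧-zero : ∀ {n} (a : Circuit n) → ⟦ a ⟧ (λ _ → 0) ≡ 0
  ⟦⟧-zero (input i)         = refl
  ⟦⟧-zero (a ⊕ b)           = cong₂ _+_ (⟦⟧-zero a) (⟦⟧-zero b)
  ⟦⟧-zero (topple d q q< a) = trans (cong (λ k → (k + q) / (2 + d)) (⟦⟧-zero a)) (m<n⇒m/n≡0 q<)

  -- `nothing` denotes the constant 0; it is kept apart from circuits because the network
  -- computing it has an output edge attached to no node, so nothing can be fed from it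
  ⟦_⟧? : ∀ {n} → Maybe (Circuit n) → (Fin n → ℕ) → ℕ
  ⟦ nothing ⟧? x = 0
  ⟦ just a  ⟧? x = ⟦ a ⟧ x

  ⟦⟧?-zero : ∀ {n} (a : Maybe (Circuit n)) → ⟦ a ⟧? (λ _ → 0) ≡ 0
  ⟦⟧?-zero nothing  = refl
  ⟦⟧?-zero (just a) = ⟦⟧-zero a

  _⊕?_ : ∀ {n} → Maybe (Circuit n) → Maybe (Circuit n) → Maybe (Circuit n)
  nothing ⊕? b       = b
  just a  ⊕? nothing = just a
  just a  ⊕? just b  = just (a ⊕ b)

  ⟦⊕?⟧ : ∀ {n} (a b : Maybe (Circuit n)) x → ⟦ a ⊕? b ⟧? x ≡ ⟦ a ⟧? x + ⟦ b ⟧? x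
  ⟦⊕?⟧ nothing  b        x = refl
  ⟦⊕?⟧ (just a) nothing  x = sym (+-identityʳ _)
  ⟦⊕?⟧ (just a) (just b) x = refl

  Expr : ℕ → Set
  Expr n = Maybe (Circuit n) × ℕ

  ⟦_⟧ₑ : ∀ {n} → Expr n → (Fin n → ℕ) → ℕ
  ⟦ a , k ⟧ₑ x = ⟦ a ⟧? x + k

  constₑ : ∀ {n} → ℕ → Expr n
  constₑ k = nothing , k

  inputₑ : ∀ {n} → Fin n → Expr n
  inputₑ i = just (input i) , 0

  _+ₑ_ : ∀ {n} → Expr n → Expr n → Expr n
  (a , k) +ₑ (b , l) = a ⊕? b , k + l

  sumₑ : ∀ {n k} → (Fin k → Expr n) → Expr n
  sumₑ {k = zero}  e = constₑ 0
  sumₑ {k = suc k} e = e zero +ₑ sumₑ (e ∘ suc)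

  -- ⌊(e + k) / (1 + d)⌋: the constant K + k = q + (2 + d) r splits into the initial state q of a
  -- toppler and the new constant r
  floorₑ : ∀ {n} (d k : ℕ) → Expr n → Expr n
  floorₑ d       k (nothing , K) = nothing , (K + k) / suc d
  floorₑ zero    k (just a  , K) = just a , K + k
  floorₑ (suc d) k (just a  , K) = just (topple d ((K + k) % (2 + d)) (m%n<n (K + k) (2 + d)) a) , (K + k) / (2 + d)

  renameₑ : ∀ {n k} → (Fin n → Fin k) → Expr n → Expr k
  renameₑ ρ (a , K) = Maybe.map (rename ρ) a , K

  ⟦+ₑ⟧ : ∀ {n} (e e′ : Expr n) x → ⟦ e +ₑ e′ ⟧ₑ x ≡ ⟦ e ⟧ₑ x + ⟦ e′ ⟧ₑ x
  ⟦+ₑ⟧ (a , k) (b , l) x = begin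
    ⟦ a ⊕? b ⟧? x + (k + l)        ≡⟨ cong (_+ (k + l)) (⟦⊕?⟧ a b x) ⟩
    ⟦ a ⟧? x + ⟦ b ⟧? x + (k + l)  ≡⟨ interchange (⟦ a ⟧? x) _ k l ⟩
    ⟦ a ⟧? x + k + (⟦ b ⟧? x + l)  ∎
    where open ≡-Reasoning

  ⟦sumₑ⟧ : ∀ {n k} (e : Fin k → Expr n) x → ⟦ sumₑ e ⟧ₑ x ≡ ∑[ j < k ] ⟦ e j ⟧ₑ x
  ⟦sumₑ⟧ {k = zero}  e x = refl
  ⟦sumₑ⟧ {k = suc k} e x = trans (⟦+ₑ⟧ (e zero) (sumₑ (e ∘ suc)) x) (cong (⟦ e zero ⟧ₑ x +_) (⟦sumₑ⟧ (e ∘ suc) x))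

  ⟦floorₑ⟧ : ∀ {n} d k (e : Expr n) x → ⟦ floorₑ d k e ⟧ₑ x ≡ (⟦ e ⟧ₑ x + k) / suc d
  ⟦floorₑ⟧ d       k (nothing , K) x = refl
  ⟦floorₑ⟧ zero    k (just a  , K) x = sym (trans (n/1≡n _) (+-assoc (⟦ a ⟧ x) K k))
  ⟦floorₑ⟧ (suc d) k (just a  , K) x = sym (begin
    (A + K + k) / L                              ≡⟨ cong (_/ L) (trans (+-assoc A K k) (cong (A +_) (m≡m%n+[m/n]*n (K + k) L))) ⟩
    (A + ((K + k) % L + (K + k) / L * L)) / L    ≡⟨ cong (_/ L) (sym (+-assoc A _ _)) ⟩
    (A + (K + k) % L + (K + k) / L * L) / L      ≡⟨ [m+kn]/n≡m/n+k (A + (K + k) % L) ((K + k) / L) L ⟩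
    (A + (K + k) % L) / L + (K + k) / L          ∎)
    where
    open ≡-Reasoning
    L A : ℕ
    L = 2 + d
    A = ⟦ a ⟧ x

  ⟦renameₑ⟧ : ∀ {n k} (ρ : Fin n → Fin k) e x → ⟦ renameₑ ρ e ⟧ₑ x ≡ ⟦ e ⟧ₑ (x ∘ ρ)
  ⟦renameₑ⟧ ρ (nothing , K) x = refl
  ⟦renameₑ⟧ ρ (just a  , K) x = cong (_+ K) (⟦rename⟧ ρ a x)

  module _ {n : ℕ} where

    Extensional : ((Fin n → ℕ) → ℕ) → Set
    Extensional F = ∀ {x y} → x ≗ y → F x ≡ F y

    Monotone : ((Fin n → ℕ) → ℕ) → Set
    Monotone F = ∀ x i → F x ≤ F (updateAt x i suc)

    Periodic : ℕ → (Fin n → ℕ) → ((Fin n → ℕ) → ℕ) → Set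
    Periodic m c F = ∀ x i → F (updateAt x i (_+ m)) ≡ F x + c i

    Represents : Expr n → ((Fin n → ℕ) → ℕ) → Set
    Represents e F = ∀ x → ⟦ e ⟧ₑ x ≡ F x

  module _ {n} (y : ℕ) (x : Fin n → ℕ) where

    ∷-updateAt-zero : ∀ f → updateAt (y ∷ x) zero f ≗ f y ∷ x
    ∷-updateAt-zero f zero    = refl
    ∷-updateAt-zero f (suc j) = refl

    ∷-updateAt-suc : ∀ i f → updateAt (y ∷ x) (suc i) f ≗ y ∷ updateAt x i f
    ∷-updateAt-suc i f zero    = refl
    ∷-updateAt-suc i f (suc j) = refl

  ∷-cong : ∀ {n} y {x x′ : Fin n → ℕ} → x ≗ x′ → y ∷ x ≗ y ∷ x′
  ∷-cong y x≗x′ zero    = refl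
  ∷-cong y x≗x′ (suc j) = x≗x′ j

  ∷-η : ∀ {n} (x : Fin (suc n) → ℕ) → x zero ∷ (x ∘ suc) ≗ x
  ∷-η x zero    = refl
  ∷-η x (suc i) = refl

  representation : ∀ {n} m (c : Fin n → ℕ) (F : (Fin n → ℕ) → ℕ) →
    Extensional F → Monotone F → Periodic (suc m) c F → Σ (Expr n) λ e → Represents e F
  representation {zero}  m c F ext mono per = constₑ (F (λ ())) , λ x → ext (λ ())
  representation {suc n} m c F ext mono per = byIncrement (c zero) refl
    where
    slice : ℕ → (Fin n → ℕ) → ℕ
    slice y x = F (y ∷ x)

    sub : ∀ r → Σ (Expr n) λ e → Represents e (slice r)
    sub r = representation m (c ∘ suc) (slice r)
      (λ x≗x′ → ext (∷-cong r x≗x′))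
      (λ x i → subst (slice r x ≤_) (ext (∷-updateAt-suc r x i suc)) (mono (r ∷ x) (suc i)))
      (λ x i → trans (ext (sym ∘ ∷-updateAt-suc r x i (_+ suc m))) (per (r ∷ x) (suc i)))

    line-step : ∀ x y → slice y x ≤ slice (suc y) x
    line-step x y = subst (slice y x ≤_) (ext (∷-updateAt-zero y x suc)) (mono (y ∷ x) zero)

    line-period : ∀ x y → slice (y + suc m) x ≡ slice y x + c zero
    line-period x y = trans (ext (sym ∘ ∷-updateAt-zero y x (_+ suc m))) (per (y ∷ x) zero)

    byIncrement : ∀ k → c zero ≡ k → Σ (Expr (suc n)) λ e → Represents e F
    byIncrement zero c₀≡0 = renameₑ suc (proj₁ (sub 0)) , λ x → begin
      ⟦ renameₑ suc (proj₁ (sub 0)) ⟧ₑ x  ≡⟨ ⟦renameₑ⟧ suc (proj₁ (sub 0)) x ⟩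
      ⟦ proj₁ (sub 0) ⟧ₑ (x ∘ suc)        ≡⟨ proj₂ (sub 0) (x ∘ suc) ⟩
      slice 0 (x ∘ suc)                   ≡⟨ periodic-zero⇒const m (λ y → slice y (x ∘ suc)) (line-step (x ∘ suc))
                                               (λ y → trans (line-period (x ∘ suc) y) (cong (_ +_) c₀≡0)) (x zero) ⟨
      slice (x zero) (x ∘ suc)            ≡⟨ ext (∷-η x) ⟩
      F x                                 ∎
      where open ≡-Reasoning
    byIncrement (suc k) c₀≡1+k = sumₑ term , λ x → begin
      ⟦ sumₑ term ⟧ₑ x                                                   ≡⟨ ⟦sumₑ⟧ term x ⟩
      ∑[ j < suc k ] ⟦ term j ⟧ₑ x                                        ≡⟨ sum-cong-≗ {suc k} (⟦term⟧ x) ⟩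
      ∑[ j < suc k ] ((x zero + floorSum (suc m) (suc k) (G x) (toℕ j)) / suc m)
        ≡⟨ floorSum-representation m (suc k) (G x) (line-step (x ∘ suc))
             (λ y → trans (line-period (x ∘ suc) y) (cong (_ +_) c₀≡1+k)) (x zero) ⟨
      G x (x zero)                                                       ≡⟨ ext (∷-η x) ⟩
      F x                                                                ∎
      where
      open ≡-Reasoning
      G : (Fin (suc n) → ℕ) → ℕ → ℕ
      G x y = slice y (x ∘ suc)
      S : Fin (suc k) → Fin (suc m) → Expr (suc n)
      S j r = floorₑ k (toℕ j) (renameₑ suc (proj₁ (sub (toℕ r))))
      term : Fin (suc k) → Expr (suc n)
      term j = floorₑ m 0 (inputₑ zero +ₑ sumₑ (S j))
      ⟦S⟧ : ∀ x j r → ⟦ S j r ⟧ₑ x ≡ (G x (toℕ r) + toℕ j) / suc k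
      ⟦S⟧ x j r = trans (⟦floorₑ⟧ k (toℕ j) (renameₑ suc (proj₁ (sub (toℕ r)))) x)
        (cong (λ v → (v + toℕ j) / suc k) (trans (⟦renameₑ⟧ suc (proj₁ (sub (toℕ r))) x) (proj₂ (sub (toℕ r)) (x ∘ suc))))
      ⟦term⟧ : ∀ x j → ⟦ term j ⟧ₑ x ≡ (x zero + floorSum (suc m) (suc k) (G x) (toℕ j)) / suc m
      ⟦term⟧ x j = begin
        ⟦ term j ⟧ₑ x                                  ≡⟨ ⟦floorₑ⟧ m 0 (inputₑ zero +ₑ sumₑ (S j)) x ⟩
        (⟦ inputₑ zero +ₑ sumₑ (S j) ⟧ₑ x + 0) / suc m
          ≡⟨ cong (_/ suc m) (trans (+-identityʳ _) (⟦+ₑ⟧ (inputₑ zero) (sumₑ (S j)) x)) ⟩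
        (x zero + 0 + ⟦ sumₑ (S j) ⟧ₑ x) / suc m       ≡⟨ cong₂ (λ y s → (y + s) / suc m) (+-identityʳ (x zero))
                                                                  (trans (⟦sumₑ⟧ (S j) x) (sum-cong-≗ {suc m} (⟦S⟧ x j))) ⟩
        (x zero + floorSum (suc m) (suc k) (G x) (toℕ j)) / suc m ∎

  -- the constant of the representing expression is F 0 = 0, since every circuit vanishes at 0
  circuit-representation : ∀ {n} m (c : Fin n → ℕ) (F : (Fin n → ℕ) → ℕ) →
    Extensional F → Monotone F → Periodic (suc m) c F → F (λ _ → 0) ≡ 0 →
    Σ (Maybe (Circuit n)) λ a → ∀ x → ⟦ a ⟧? x ≡ F x
  circuit-representation m c F ext mono per F0≡0 with representation m c F ext mono per
  ... | (a , K) , represents = a , λ x → trans (sym (trans (cong (⟦ a ⟧? x +_) K≡0) (+-identityʳ _))) (represents x)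
    where
    K≡0 : K ≡ 0
    K≡0 = trans (sym (cong (_+ K) (⟦⟧?-zero a))) (trans (represents (λ _ → 0)) F0≡0)

module Processors where

  open import Data.Nat using (ℕ; zero; suc; _+_; _*_; _∸_; _≤_; _!; pred)
  open import Data.Nat.Properties
  open import Data.Nat.Divisibility using (divides; ∣-trans; m∣m*n; m≤n⇒m!∣n!)
  open import Data.Fin using (Fin; zero; suc; toℕ)
  open import Data.Fin.Properties using (pigeonhole; toℕ<n)
  open import Data.List using (List; []; _∷_; _++_; replicate; concatMap; tabulate)
  open import Data.List.Properties using (++-assoc)
  open import Data.List.Relation.Binary.Permutation.Propositional as ↭ using (_↭_; ↭-trans; ↭-reflexive; prep; swap)
  open import Data.List.Relation.Binary.Permutation.Propositional.Properties using (++⁺ˡ; ++-comm)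
  open import Data.Product using (∃; _×_; _,_; proj₁; proj₂)
  open import Data.Vec.Functional using (updateAt)
  open import Data.Vec.Functional.Properties using (updateAt-cong)
  open import Function using (_∘_; id)
  open import Relation.Binary.PropositionalEquality
  open Circuits using (Extensional; Monotone; Periodic)

  replicate-+ : ∀ {A : Set} m n (a : A) → replicate (m + n) a ≡ replicate m a ++ replicate n a
  replicate-+ zero    n a = refl
  replicate-+ (suc m) n a = cong (a ∷_) (replicate-+ m n a)

  word : ∀ {A : Set} {n} → (Fin n → A) → (Fin n → ℕ) → List A
  word {n = zero}  g x = []
  word {n = suc n} g x = replicate (x zero) (g zero) ++ word (g ∘ suc) (x ∘ suc)

  word-cong : ∀ {A : Set} {n} (g : Fin n → A) {x y} → x ≗ y → word g x ≡ word g y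
  word-cong {n = zero}  g x≗y = refl
  word-cong {n = suc n} g x≗y = cong₂ (λ k → replicate k (g zero) ++_) (x≗y zero) (word-cong (g ∘ suc) (x≗y ∘ suc))

  word-zero : ∀ {A : Set} {n} (g : Fin n → A) → word g (λ _ → 0) ≡ []
  word-zero {n = zero}  g = refl
  word-zero {n = suc n} g = word-zero (g ∘ suc)

  word-updateAt : ∀ {A : Set} {n} (g : Fin n → A) x i k → word g (updateAt x i (_+ k)) ↭ word g x ++ replicate k (g i)
  word-updateAt {A} {suc n} g x zero k = ↭-trans
    (↭-reflexive (trans (cong (_++ rest) (replicate-+ (x zero) k (g zero))) (++-assoc here extra rest)))
    (↭-trans (++⁺ˡ here (++-comm extra rest)) (↭-reflexive (sym (++-assoc here rest extra))))
    where
    here extra rest : List A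
    here  = replicate (x zero) (g zero)
    extra = replicate k (g zero)
    rest  = word (g ∘ suc) (x ∘ suc)
  word-updateAt {n = suc n} g x (suc i) k = ↭-trans
    (++⁺ˡ (replicate (x zero) (g zero)) (word-updateAt (g ∘ suc) (x ∘ suc) i k))
    (↭-reflexive (sym (++-assoc (replicate (x zero) (g zero)) _ _)))

  module _ {nA nB} (P : Processor nA nB) where
    open Processor P

    inputWord≡word : ∀ x → inputWord P x ≡ word id x
    inputWord≡word x = tabulated id
      where
      tabulated : ∀ {n} (h : Fin n → Fin nA) → concatMap (λ a → replicate (x a) a) (tabulate h) ≡ word h (x ∘ h)
      tabulated {zero}  h = refl
      tabulated {suc n} h = cong (replicate (x (h zero)) (h zero) ++_) (tabulated (h ∘ suc))

    runState-++ : ∀ q u v → runState P q (u ++ v) ≡ runState P (runState P q u) v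
    runState-++ q []      v = refl
    runState-++ q (i ∷ u) v = runState-++ (t i q) u v

    runOut-++ : ∀ q u v b → runOut P q (u ++ v) b ≡ runOut P q u b + runOut P (runState P q u) v b
    runOut-++ q []      v b = refl
    runOut-++ q (i ∷ u) v b = trans (cong (o i q b +_) (runOut-++ (t i q) u v b)) (sym (+-assoc (o i q b) _ _))

    compute-extensional : ∀ b → Extensional (λ x → compute P x b)
    compute-extensional b {x} {y} x≗y =
      cong (λ w → runOut P q0 w b) (trans (inputWord≡word x) (trans (word-cong id x≗y) (sym (inputWord≡word y))))

    compute-zero : ∀ b → compute P (λ _ → 0) b ≡ 0
    compute-zero b = cong (λ w → runOut P q0 w b) (trans (inputWord≡word (λ _ → 0)) (word-zero id))

    module _ (abelian : IsAbelian P) where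
      private
        t-comm : ∀ i j q → t i (t j q) ≡ t j (t i q)
        t-comm = proj₁ abelian
        o-comm : ∀ i j q b → o i q b + o j (t i q) b ≡ o j q b + o i (t j q) b
        o-comm = proj₂ abelian

      runState-↭ : ∀ {u v} → u ↭ v → ∀ q → runState P q u ≡ runState P q v
      runState-↭ ↭.refl            q = refl
      runState-↭ (prep i p)        q = runState-↭ p (t i q)
      runState-↭ {i ∷ j ∷ u} (swap .i .j p) q = trans (cong (λ s → runState P s u) (t-comm j i q)) (runState-↭ p (t i (t j q)))
      runState-↭ (↭.trans p p′)    q = trans (runState-↭ p q) (runState-↭ p′ q)

      runOut-↭ : ∀ {u v} → u ↭ v → ∀ q b → runOut P q u b ≡ runOut P q v b
      runOut-↭ ↭.refl         q b = refl
      runOut-↭ (prep i p)     q b = cong (o i q b +_) (runOut-↭ p (t i q) b)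
      runOut-↭ {i ∷ j ∷ u} {.j ∷ .i ∷ v} (swap .i .j p) q b = begin
        o i q b + (o j (t i q) b + runOut P (t j (t i q)) u b) ≡⟨ sym (+-assoc (o i q b) _ _) ⟩
        o i q b + o j (t i q) b + runOut P (t j (t i q)) u b
          ≡⟨ cong₂ _+_ (o-comm i j q b) (trans (cong (λ s → runOut P s u b) (t-comm j i q)) (runOut-↭ p (t i (t j q)) b)) ⟩
        o j q b + o i (t j q) b + runOut P (t i (t j q)) v b   ≡⟨ +-assoc (o j q b) _ _ ⟩
        o j q b + (o i (t j q) b + runOut P (t i (t j q)) v b) ∎
        where open ≡-Reasoning
      runOut-↭ (↭.trans p p′) q b = trans (runOut-↭ p q b) (runOut-↭ p′ q b)

      t-runState : ∀ i q w → t i (runState P q w) ≡ runState P (t i q) w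
      t-runState i q []      = refl
      t-runState i q (j ∷ w) = trans (t-runState i (t j q) w) (cong (λ s → runState P s w) (t-comm i j q))

      power : Fin nA → ℕ → Fin nQ → Fin nQ
      power i k q = runState P q (replicate k i)

      power-+ : ∀ i a d q → power i (a + d) q ≡ power i d (power i a q)
      power-+ i a d q = trans (cong (runState P q) (replicate-+ a d i)) (runState-++ q (replicate a i) (replicate d i))

      power-runState : ∀ i d q w → power i d (runState P q w) ≡ runState P (power i d q) w
      power-runState i zero    q w = refl
      power-runState i (suc d) q w = trans (cong (power i d) (t-runState i q w)) (power-runState i d (t i q) w)

      power-multiple : ∀ i d q → power i d q ≡ q → ∀ r → power i (r * d) q ≡ q
      power-multiple i d q cycle zero    = refl
      power-multiple i d q cycle (suc r) =
        trans (power-+ i d (r * d) q) (trans (cong (power i (r * d)) cycle) (power-multiple i d q cycle r))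

      compute-updateAt : ∀ x i k b →
        compute P (updateAt x i (_+ k)) b ≡ compute P x b + runOut P (runState P q0 (inputWord P x)) (replicate k i) b
      compute-updateAt x i k b = begin
        runOut P q0 (inputWord P (updateAt x i (_+ k))) b   ≡⟨ cong (λ w → runOut P q0 w b) (inputWord≡word (updateAt x i (_+ k))) ⟩
        runOut P q0 (word id (updateAt x i (_+ k))) b       ≡⟨ runOut-↭ (word-updateAt id x i k) q0 b ⟩
        runOut P q0 (word id x ++ replicate k i) b          ≡⟨ runOut-++ q0 (word id x) (replicate k i) b ⟩
        runOut P q0 (word id x) b + runOut P (runState P q0 (word id x)) (replicate k i) b
          ≡⟨ cong (λ w → runOut P q0 w b + runOut P (runState P q0 w) (replicate k i) b) (sym (inputWord≡word x)) ⟩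
        runOut P q0 (inputWord P x) b + runOut P (runState P q0 (inputWord P x)) (replicate k i) b ∎
        where open ≡-Reasoning

      compute-monotone : ∀ b → Monotone (λ x → compute P x b)
      compute-monotone b x i = begin
        compute P x b                                ≤⟨ m≤m+n _ _ ⟩
        compute P x b + runOut P (runState P q0 (inputWord P x)) (replicate 1 i) b
                                                     ≡⟨ compute-updateAt x i 1 b ⟨
        compute P (updateAt x i (_+ 1)) b            ≡⟨ compute-extensional b (updateAt-cong i (λ n → +-comm n 1) x) ⟩
        compute P (updateAt x i suc) b               ∎
        where open ≤-Reasoning

      module _ (recurrent : IsRecurrent P) where

        power-cycle : ∀ i q → ∃ λ d → (1 ≤ d × d ≤ nQ) × power i d q ≡ q
        power-cycle i q with pigeonhole (n<1+n nQ) (λ k → power i (toℕ k) q)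
        ... | k₁ , k₂ , k₁<k₂ , same = d , (m<n⇒0<n∸m k₁<k₂ , d≤nQ) , back
          where
          d : ℕ
          d = toℕ k₂ ∸ toℕ k₁
          d≤nQ : d ≤ nQ
          d≤nQ = ≤-trans (m∸n≤m (toℕ k₂) (toℕ k₁)) (≤-pred (toℕ<n k₂))
          q′ : Fin nQ
          q′ = power i (toℕ k₁) q
          cycle : power i d q′ ≡ q′
          cycle = trans (sym (power-+ i (toℕ k₁) d q)) (trans (cong (λ k → power i k q) (m+[n∸m]≡n (<⇒≤ k₁<k₂))) (sym same))
          -- q lies on the cycle through q′ because it is reachable from q′
          w : List (Fin nA)
          w = proj₁ (recurrent q′ q)
          back : power i d q ≡ q
          back = begin
            power i d q                  ≡⟨ cong (power i d) (sym (proj₂ (recurrent q′ q))) ⟩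
            power i d (runState P q′ w)  ≡⟨ power-runState i d q′ w ⟩
            runState P (power i d q′) w  ≡⟨ cong (λ s → runState P s w) cycle ⟩
            runState P q′ w              ≡⟨ proj₂ (recurrent q′ q) ⟩
            q                            ∎
            where open ≡-Reasoning

        power-nQ! : ∀ i q → power i (nQ !) q ≡ q
        power-nQ! i q with power-cycle i q
        ... | suc d , (_ , d≤nQ) , cycle with ∣-trans (m∣m*n (d !)) (m≤n⇒m!∣n! d≤nQ)
        ...   | divides r nQ!≡r*d = trans (cong (λ k → power i k q) nQ!≡r*d) (power-multiple i (suc d) q cycle r)

        burst : Fin nA → Fin nB → Fin nQ → ℕ
        burst i b q = runOut P q (replicate (nQ !) i) b

        -- the word of nQ! letters i leads back to its starting state, so a letter j read before it
        -- produces the same output as after it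
        burst-t : ∀ i b j q → burst i b (t j q) ≡ burst i b q
        burst-t i b j q = +-cancelˡ-≡ (o j q b) _ _ (begin
          o j q b + runOut P (t j q) R b                   ≡⟨ runOut-↭ (++-comm (j ∷ []) R) q b ⟩
          runOut P q (R ++ j ∷ []) b                       ≡⟨ runOut-++ q R (j ∷ []) b ⟩
          runOut P q R b + (o j (power i (nQ !) q) b + 0)  ≡⟨ cong (λ s → runOut P q R b + (o j s b + 0)) (power-nQ! i q) ⟩
          runOut P q R b + (o j q b + 0)                   ≡⟨ cong (runOut P q R b +_) (+-identityʳ _) ⟩
          runOut P q R b + o j q b                         ≡⟨ +-comm _ (o j q b) ⟩
          o j q b + runOut P q R b                         ∎)
          where
          open ≡-Reasoning
          R : List (Fin nA)
          R = replicate (nQ !) i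

        burst-runState : ∀ i b q w → burst i b (runState P q w) ≡ burst i b q
        burst-runState i b q []      = refl
        burst-runState i b q (j ∷ w) = trans (burst-runState i b (t j q) w) (burst-t i b j q)

        compute-periodic : ∀ b → Periodic (suc (pred (nQ !))) (λ i → burst i b q0) (λ x → compute P x b)
        compute-periodic b x i = begin
          compute P (updateAt x i (_+ suc (pred (nQ !)))) b
            ≡⟨ compute-extensional b (updateAt-cong i (λ k → cong (k +_) (suc-pred (nQ !) {{nQ !≢0}})) x) ⟩
          compute P (updateAt x i (_+ nQ !)) b
            ≡⟨ compute-updateAt x i (nQ !) b ⟩
          compute P x b + burst i b (runState P q0 (inputWord P x))
            ≡⟨ cong (compute P x b +_) (burst-runState i b q0 (inputWord P x)) ⟩
          compute P x b + burst i b q0 ∎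
          where open ≡-Reasoning

module Networks where

  open import Data.Nat using (ℕ; zero; suc; _+_; _≤_; _<_; z≤n; _<?_)
  open import Data.Nat.Properties hiding (_≟_)
  open import Data.Bool using (Bool; true; false; if_then_else_)
  open import Data.Bool.Properties using (if-eta)
  open import Data.Fin using (Fin; zero; suc; toℕ; _≟_)
  open import Data.Fin.Properties using (any?)
  open import Data.Maybe using (Maybe; just; nothing; maybe′)
  open import Data.Product using (Σ; _×_; _,_; proj₁; proj₂)
  open import Data.Empty using (⊥-elim)
  open import Function using (_∘_)
  open import Relation.Nullary using (yes; no)
  open import Relation.Nullary.Decidable using (dec-true; dec-false)
  open import Relation.Binary.PropositionalEquality
  open import Algebra.Properties.CommutativeMonoid.Sum +-0-commutativeMonoid
    using (sum; sum-syntax; sum-cong-≗; sum-replicate-zero; ∑-distrib-+)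
  open import Algebra.Properties.CommutativeSemigroup +-commutativeSemigroup
    using (xy∙z≈xz∙y; x∙yz≈y∙xz)
  open Arithmetic using (sum-mono-≤; sum-mono-<; step-mono⇒mono)

  bit : Bool → ℕ
  bit b = if b then 1 else 0

  bit-+ : ∀ b n → bit b + n ≡ (if b then suc n else n)
  bit-+ true  n = refl
  bit-+ false n = refl

  stateAfter : Gate → ℕ → ℕ
  stateAfter g zero    = initState g
  stateAfter g (suc f) = proj₁ (gateStep g (stateAfter g f))

  emittedAfter : Gate → ℕ → ℕ
  emittedAfter g zero    = 0
  emittedAfter g (suc f) = emittedAfter g f + bit (proj₂ (gateStep g (stateAfter g f)))

  emittedAfter-mono : ∀ g {f f′} → f ≤ f′ → emittedAfter g f ≤ emittedAfter g f′
  emittedAfter-mono g = step-mono⇒mono (emittedAfter g) (λ f → m≤m+n _ _)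

  ==-refl : ∀ {n} (i : Fin n) → (i == i) ≡ true
  ==-refl i = dec-true (i ≟ i) refl

  ==-false : ∀ {n} {i j : Fin n} → i ≢ j → (i == j) ≡ false
  ==-false {i = i} {j} = dec-false (i ≟ j)

  ==-true : ∀ {n} {i j : Fin n} → (i == j) ≡ true → i ≡ j
  ==-true {i = i} {j} eq with i ≟ j | eq
  ... | yes i≡j | _ = i≡j

  ==-sym : ∀ {n} (i j : Fin n) → (i == j) ≡ (j == i)
  ==-sym i j with i ≟ j
  ... | yes refl = sym (==-refl i)
  ... | no i≢j   = sym (==-false (i≢j ∘ sym))

  sum-δ : ∀ {n} (i : Fin n) (g : Fin n → ℕ) → ∑[ k < n ] (if i == k then g k else 0) ≡ g i
  sum-δ {suc n} zero    g = trans (cong (g zero +_) (sum-replicate-zero n)) (+-identityʳ _)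
  sum-δ {suc n} (suc i) g = sum-δ i (g ∘ suc)

  fiberSum : ∀ {m n} → (Fin m → Maybe (Fin n)) → Fin n → (Fin m → ℕ) → ℕ
  fiberSum {m} h v f = ∑[ k < m ] (if atNode (h k) v then f k else 0)

  count≡fiberSum : ∀ {m n} (h : Fin m → Maybe (Fin n)) v → count (λ k → atNode (h k) v) ≡ fiberSum h v (λ _ → 1)
  count≡fiberSum {zero}  h v = refl
  count≡fiberSum {suc m} h v = cong (bit (atNode (h zero) v) +_) (count≡fiberSum (h ∘ suc) v)

  module _ {m n} (h : Fin m → Maybe (Fin n)) (v : Fin n) where

    fiberSum-cong : ∀ {f g} → (∀ k → atNode (h k) v ≡ true → f k ≡ g k) → fiberSum h v f ≡ fiberSum h v g
    fiberSum-cong {f} {g} f≐g = sum-cong-≗ {m} pointwise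
      where
      pointwise : ∀ k → (if atNode (h k) v then f k else 0) ≡ (if atNode (h k) v then g k else 0)
      pointwise k with atNode (h k) v in at
      ... | true  = f≐g k at
      ... | false = refl

    fiberSum-cong-map : ∀ {h′} → h ≗ h′ → ∀ f → fiberSum h v f ≡ fiberSum h′ v f
    fiberSum-cong-map h≗h′ f = sum-cong-≗ {m} λ k → cong (λ u → if atNode u v then f k else 0) (h≗h′ k)

    fiberSum-zero : fiberSum h v (λ _ → 0) ≡ 0
    fiberSum-zero = trans (sum-cong-≗ {m} (λ k → if-eta (atNode (h k) v))) (sum-replicate-zero m)

    private
      restricted-≤ : ∀ {f g : Fin m → ℕ} → (∀ k → f k ≤ g k) →
                     ∀ k → (if atNode (h k) v then f k else 0) ≤ (if atNode (h k) v then g k else 0)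
      restricted-≤ f≤g k with atNode (h k) v
      ... | true  = f≤g k
      ... | false = z≤n

    fiberSum-mono-≤ : ∀ {f g} → (∀ k → f k ≤ g k) → fiberSum h v f ≤ fiberSum h v g
    fiberSum-mono-≤ {f} {g} f≤g = sum-mono-≤ (restricted-≤ {f} {g} f≤g)

    fiberSum-mono-< : ∀ {f g} k → atNode (h k) v ≡ true → (∀ k → f k ≤ g k) → f k < g k → fiberSum h v f < fiberSum h v g
    fiberSum-mono-< {f} {g} k at f≤g fk<gk =
      sum-mono-< k (restricted-≤ {f} {g} f≤g) (subst (λ b → (if b then f k else 0) < (if b then g k else 0)) (sym at) fk<gk)

  module Semantics {nA nB : ℕ} (N : Network nA nB) where
    open Network N
    open NetSem N hiding (Acyclic; WellFormed)
    open Config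

    emits : (Fin nodes → ℕ) → Fin nodes → ℕ
    emits L v = emittedAfter (gate v) (L v)

    received : (Fin nA → ℕ) → (Fin nInt → ℕ) → Fin nodes → ℕ
    received x y v = fiberSum (just ∘ inHead) v x + fiberSum (just ∘ intHead) v y

    -- L v is the number of letters node v processes when the inputs are x
    Consistent : (Fin nA → ℕ) → (Fin nodes → ℕ) → Set
    Consistent x L = ∀ v → L v ≡ received x (emits L ∘ intTail) v

    output : (Fin nodes → ℕ) → Fin nB → ℕ
    output L b = maybe′ (emits L) 0 (outTail b)

    output-cong : ∀ {L L′} → L ≗ L′ → output L ≗ output L′
    output-cong L≗L′ b with outTail b
    ... | nothing = refl
    ... | just v  = cong (emittedAfter (gate v)) (L≗L′ v)

    inEdges : Fin nodes → ℕ
    inEdges = received (λ _ → 1) (λ _ → 1)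

    outEdges : Fin nodes → ℕ
    outEdges v = fiberSum (just ∘ intTail) v (λ _ → 1) + fiberSum outTail v (λ _ → 1) + fiberSum (just ∘ trashTail) v (λ _ → 1)

    ArityAt : Fin nodes → Set
    ArityAt v = inEdges v ≡ inArity (gate v) × outEdges v ≡ outArity (gate v)

    arities⇒wellFormed : (∀ v → ArityAt v) → WellFormed N
    arities⇒wellFormed arity v =
      trans (cong₂ _+_ (count≡fiberSum (just ∘ inHead) v) (count≡fiberSum (just ∘ intHead) v)) (proj₁ (arity v)) ,
      trans (cong₂ _+_ (cong₂ _+_ (count≡fiberSum (just ∘ intTail) v) (count≡fiberSum outTail v))
                       (count≡fiberSum (just ∘ trashTail) v)) (proj₂ (arity v))

    wellFormed⇒arities : WellFormed N → ∀ v → ArityAt v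
    wellFormed⇒arities wf v =
      trans (sym (cong₂ _+_ (count≡fiberSum (just ∘ inHead) v) (count≡fiberSum (just ∘ intHead) v))) (proj₁ (wf v)) ,
      trans (sym (cong₂ _+_ (cong₂ _+_ (count≡fiberSum (just ∘ intTail) v) (count≡fiberSum outTail v))
                            (count≡fiberSum (just ∘ trashTail) v))) (proj₂ (wf v))

    Sorted : Set
    Sorted = ∀ e → toℕ (intTail e) < toℕ (intHead e)

    sorted⇒acyclic : Sorted → Acyclic N
    sorted⇒acyclic sorted v p = <-irrefl refl (increasing p)
      where
      increasing : ∀ {v w} → Path⁺ v w → toℕ v < toℕ w
      increasing (edge e)   = sorted e
      increasing (step e p) = <-trans (sorted e) (increasing p)

    consistent-unique : Sorted → ∀ {x L L′} → Consistent x L → Consistent x L′ → L ≗ L′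
    consistent-unique sorted {x} {L} {L′} con con′ v = below (suc (toℕ v)) v (n<1+n _)
      where
      below : ∀ k v → toℕ v < k → L v ≡ L′ v
      below (suc k) v v<1+k = begin
        L v                                ≡⟨ con v ⟩
        received x (emits L ∘ intTail) v   ≡⟨ cong (fiberSum (just ∘ inHead) v x +_) (fiberSum-cong (just ∘ intHead) v tails) ⟩
        received x (emits L′ ∘ intTail) v  ≡⟨ con′ v ⟨
        L′ v                               ∎
        where
        open ≡-Reasoning
        tails : ∀ e → (intHead e == v) ≡ true → emits L (intTail e) ≡ emits L′ (intTail e)
        tails e at = cong (emittedAfter (gate (intTail e)))
          (below k (intTail e) (<-≤-trans (subst (λ w → toℕ (intTail e) < toℕ w) (==-true at) (sorted e)) (≤-pred v<1+k)))

    fiberSum-addIf : ∀ {m} (h : Fin m → Maybe (Fin nodes)) v i f →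
                     fiberSum h v (addIf (i ==_) f) ≡ bit (atNode (h i) v) + fiberSum h v f
    fiberSum-addIf {m} h v i f = begin
      fiberSum h v (addIf (i ==_) f)
        ≡⟨ sum-cong-≗ {m} pointwise ⟩
      ∑[ k < m ] ((if i == k then bit (atNode (h k) v) else 0) + (if atNode (h k) v then f k else 0))
        ≡⟨ ∑-distrib-+ (λ k → if i == k then bit (atNode (h k) v) else 0) _ ⟩
      ∑[ k < m ] (if i == k then bit (atNode (h k) v) else 0) + fiberSum h v f
        ≡⟨ cong (_+ fiberSum h v f) (sum-δ i (λ k → bit (atNode (h k) v))) ⟩
      bit (atNode (h i) v) + fiberSum h v f ∎
      where
      open ≡-Reasoning
      pointwise : ∀ k → (if atNode (h k) v then addIf (i ==_) f k else 0)
                      ≡ (if i == k then bit (atNode (h k) v) else 0) + (if atNode (h k) v then f k else 0)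
      pointwise k with atNode (h k) v | i == k
      ... | true  | true  = refl
      ... | true  | false = refl
      ... | false | true  = refl
      ... | false | false = refl

    sum-addIf : ∀ {n} (i : Fin n) (f : Fin n → ℕ) → sum (addIf (i ==_) f) ≡ suc (sum f)
    sum-addIf {n} i f = begin
      sum (addIf (i ==_) f)           ≡⟨ sum-cong-≗ {n} (λ k → sym (bit-+ (i == k) (f k))) ⟩
      ∑[ k < n ] (bit (i == k) + f k) ≡⟨ ∑-distrib-+ (λ k → bit (i == k)) f ⟩
      ∑[ k < n ] bit (i == k) + sum f ≡⟨ cong (_+ sum f) (sum-δ i (λ _ → 1)) ⟩
      suc (sum f)                     ∎
      where open ≡-Reasoning

    firing : Config → Fin nodes → Bool
    firing c v = proj₂ (gateStep (gate v) (st c v))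

    process-inCnt : ∀ c v a → inCnt (process c v) a ≡ inCnt c a
    process-inCnt c v a with gateStep (gate v) (st c v)
    ... | _ , false = refl
    ... | _ , true  = refl

    process-st : ∀ c v w → st (process c v) w ≡ (if v == w then proj₁ (gateStep (gate v) (st c v)) else st c w)
    process-st c v w with gateStep (gate v) (st c v)
    ... | _ , false = refl
    ... | _ , true  = refl

    private
      unchanged : ∀ b n → n ≡ n + (if b then 0 else 0)
      unchanged b n = sym (trans (cong (n +_) (if-eta b)) (+-identityʳ n))

      incremented : ∀ b n → (if b then suc n else n) ≡ n + bit b
      incremented b n = trans (sym (bit-+ b n)) (+-comm (bit b) n)

    process-intCnt : ∀ c v e → intCnt (process c v) e ≡ intCnt c e + (if intTail e == v then bit (firing c v) else 0)
    process-intCnt c v e with gateStep (gate v) (st c v)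
    ... | _ , false = unchanged (intTail e == v) (intCnt c e)
    ... | _ , true  = incremented (intTail e == v) (intCnt c e)

    process-outCnt : ∀ c v b → outCnt (process c v) b ≡ outCnt c b + (if atNode (outTail b) v then bit (firing c v) else 0)
    process-outCnt c v b with gateStep (gate v) (st c v)
    ... | _ , false = unchanged (atNode (outTail b) v) (outCnt c b)
    ... | _ , true  = incremented (atNode (outTail b) v) (outCnt c b)

    -- whether node v emits on processing its (P v + 1)-th letter
    firesAfter : (Fin nodes → ℕ) → Fin nodes → Bool
    firesAfter P v = proj₂ (gateStep (gate v) (stateAfter (gate v) (P v)))

    emits-addIf : ∀ P v w → emits (addIf (v ==_) P) w ≡ emits P w + (if w == v then bit (firesAfter P v) else 0)
    emits-addIf P v w rewrite ==-sym v w with w == v in w==v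
    ... | true with refl ← ==-true {i = w} {v} w==v = refl
    ... | false = sym (+-identityʳ _)

    output-addIf : ∀ P v b → output (addIf (v ==_) P) b ≡ output P b + (if atNode (outTail b) v then bit (firesAfter P v) else 0)
    output-addIf P v b with outTail b
    ... | nothing = refl
    ... | just w  = emits-addIf P v w

    -- C is the configuration reached once each node v has processed P v letters and
    -- `consumed e` letters have been taken off each internal edge e
    record Emitted (C : Config) (P : Fin nodes → ℕ) (consumed : Fin nInt → ℕ) : Set where
      field
        internal : ∀ e → intCnt C e + consumed e ≡ emits P (intTail e)
        outputs  : ∀ b → outCnt C b ≡ output P b
        states   : ∀ v → st C v ≡ stateAfter (gate v) (P v)

    emitted-cong : ∀ {C P P′ consumed} → P ≗ P′ → Emitted C P consumed → Emitted C P′ consumed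
    emitted-cong P≗P′ E = record
      { internal = λ e → trans (internal e) (cong (emittedAfter (gate (intTail e))) (P≗P′ (intTail e)))
      ; outputs  = λ b → trans (outputs b) (output-cong P≗P′ b)
      ; states   = λ v → trans (states v) (cong (stateAfter (gate v)) (P≗P′ v))
      }
      where open Emitted E

    process-emitted : ∀ {C P consumed} v → Emitted C P consumed → Emitted (process C v) (addIf (v ==_) P) consumed
    process-emitted {C} {P} {consumed} v E = record
      { internal = λ e → begin
          intCnt (process C v) e + consumed e
            ≡⟨ cong (_+ consumed e) (process-intCnt C v e) ⟩
          intCnt C e + fired (intTail e == v) (firing C v) + consumed e
            ≡⟨ xy∙z≈xz∙y (intCnt C e) _ (consumed e) ⟩
          intCnt C e + consumed e + fired (intTail e == v) (firing C v)
            ≡⟨ cong₂ _+_ (internal e) (cong (fired (intTail e == v)) sameFiring) ⟩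
          emits P (intTail e) + fired (intTail e == v) (firesAfter P v)
            ≡⟨ emits-addIf P v (intTail e) ⟨
          emits (addIf (v ==_) P) (intTail e) ∎
      ; outputs = λ b → begin
          outCnt (process C v) b
            ≡⟨ process-outCnt C v b ⟩
          outCnt C b + fired (atNode (outTail b) v) (firing C v)
            ≡⟨ cong₂ _+_ (outputs b) (cong (fired (atNode (outTail b) v)) sameFiring) ⟩
          output P b + fired (atNode (outTail b) v) (firesAfter P v)
            ≡⟨ output-addIf P v b ⟨
          output (addIf (v ==_) P) b ∎
      ; states = λ w → trans (process-st C v w) (newState w)
      }
      where
      open Emitted E
      open ≡-Reasoning
      fired : Bool → Bool → ℕ
      fired here f = if here then bit f else 0
      sameFiring : firing C v ≡ firesAfter P v
      sameFiring = cong (λ s → proj₂ (gateStep (gate v) s)) (states v)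
      newState : ∀ w → (if v == w then proj₁ (gateStep (gate v) (st C v)) else st C w)
                     ≡ stateAfter (gate w) (addIf (v ==_) P w)
      newState w with v == w in v==w
      ... | true with refl ← ==-true {i = v} {w} v==w = cong (λ s → proj₁ (gateStep (gate v) s)) (states v)
      ... | false = states w

    dec-addIf : ∀ {n} (i : Fin n) (f g : Fin n → ℕ) → 0 < f i → ∀ j → dec i f j + addIf (i ==_) g j ≡ f j + g j
    dec-addIf i f g 0<fi j with i == j in i==j
    ... | false = refl
    ... | true with refl ← ==-true {i = i} {j} i==j with f i | 0<fi
    ...   | suc k | _ = +-suc k (g i)

    received-addIf-in : ∀ x y a → received (addIf (a ==_) x) y ≗ addIf (inHead a ==_) (received x y)
    received-addIf-in x y a v = begin
      fiberSum (just ∘ inHead) v (addIf (a ==_) x) + Y   ≡⟨ cong (_+ Y) (fiberSum-addIf (just ∘ inHead) v a x) ⟩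
      bit (inHead a == v) + X + Y                        ≡⟨ +-assoc (bit (inHead a == v)) X Y ⟩
      bit (inHead a == v) + (X + Y)                      ≡⟨ bit-+ (inHead a == v) (X + Y) ⟩
      addIf (inHead a ==_) (received x y) v              ∎
      where
      open ≡-Reasoning
      X = fiberSum (just ∘ inHead) v x
      Y = fiberSum (just ∘ intHead) v y

    received-addIf-int : ∀ x y e → received x (addIf (e ==_) y) ≗ addIf (intHead e ==_) (received x y)
    received-addIf-int x y e v = begin
      X + fiberSum (just ∘ intHead) v (addIf (e ==_) y)  ≡⟨ cong (X +_) (fiberSum-addIf (just ∘ intHead) v e y) ⟩
      X + (bit (intHead e == v) + Y)                     ≡⟨ x∙yz≈y∙xz X (bit (intHead e == v)) Y ⟩
      bit (intHead e == v) + (X + Y)                     ≡⟨ bit-+ (intHead e == v) (X + Y) ⟩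
      addIf (intHead e ==_) (received x y) v             ∎
      where
      open ≡-Reasoning
      X = fiberSum (just ∘ inHead) v x
      Y = fiberSum (just ∘ intHead) v y

    module Execution (x : Fin nA → ℕ) (L : Fin nodes → ℕ) (sorted : Sorted) (consistent : Consistent x L) where

      -- C arises from the initial configuration by taking `takenIn a` letters off input edge a
      -- and `takenInt e` off internal edge e, each processed by the node they lead to
      record Tracked (C : Config) : Set where
        field
          takenIn  : Fin nA → ℕ
          takenInt : Fin nInt → ℕ
          inputs   : ∀ a → inCnt C a + takenIn a ≡ x a
          emitted  : Emitted C (received takenIn takenInt) takenInt
          bounded  : ∀ v → received takenIn takenInt v ≤ L v

        processed : Fin nodes → ℕ
        processed = received takenIn takenInt

      open Tracked

      addIf-bounded : ∀ {P} v → P v < L v → (∀ w → P w ≤ L w) → ∀ w → addIf (v ==_) P w ≤ L w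
      addIf-bounded v Pv<Lv P≤L w with v == w in v==w
      ... | true with refl ← ==-true {i = v} {w} v==w = Pv<Lv
      ... | false = P≤L w

      module _ {C} (T : Tracked C) where

        private
          takenIn≤ : ∀ a → takenIn T a ≤ x a
          takenIn≤ a = subst (takenIn T a ≤_) (inputs T a) (m≤n+m _ _)

          takenInt≤ : ∀ e → takenInt T e ≤ emits L (intTail e)
          takenInt≤ e = ≤-trans (subst (takenInt T e ≤_) (Emitted.internal (emitted T) e) (m≤n+m _ _))
                                (emittedAfter-mono (gate (intTail e)) (bounded T (intTail e)))

        pending-in-< : ∀ a → 0 < inCnt C a → processed T (inHead a) < L (inHead a)
        pending-in-< a pos = subst (processed T (inHead a) <_) (sym (consistent (inHead a))) (+-mono-<-≤
          (fiberSum-mono-< (just ∘ inHead) (inHead a) a (==-refl (inHead a)) takenIn≤ (subst (takenIn T a <_) (inputs T a) (m<n+m _ pos)))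
          (fiberSum-mono-≤ (just ∘ intHead) (inHead a) takenInt≤))

        pending-int-< : ∀ e → 0 < intCnt C e → processed T (intHead e) < L (intHead e)
        pending-int-< e pos = subst (processed T (intHead e) <_) (sym (consistent (intHead e))) (+-mono-≤-<
          (fiberSum-mono-≤ (just ∘ inHead) (intHead e) takenIn≤)
          (fiberSum-mono-< (just ∘ intHead) (intHead e) e (==-refl (intHead e)) takenInt≤
            (<-≤-trans (subst (takenInt T e <_) (Emitted.internal (emitted T) e) (m<n+m _ pos))
                       (emittedAfter-mono (gate (intTail e)) (bounded T (intTail e))))))

        Step : Config → Set
        Step C′ = Σ (Tracked C′) λ T′ → sum (processed T′) ≡ suc (sum (processed T))

        step-in : ∀ a → 0 < inCnt C a → Step (process (record C { inCnt = dec a (inCnt C) }) (inHead a))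
        step-in a pos = record
          { takenIn  = addIf (a ==_) (takenIn T)
          ; takenInt = takenInt T
          ; inputs   = λ a′ → trans (cong (_+ _) (process-inCnt _ (inHead a) a′))
                                    (trans (dec-addIf a (inCnt C) (takenIn T) pos a′) (inputs T a′))
          ; emitted  = emitted-cong (sym ∘ moved) (process-emitted (inHead a) (record
              { internal = Emitted.internal (emitted T) ; outputs = Emitted.outputs (emitted T) ; states = Emitted.states (emitted T) }))
          ; bounded  = λ w → subst (_≤ L w) (sym (moved w)) (addIf-bounded (inHead a) (pending-in-< a pos) (bounded T) w)
          } , trans (sum-cong-≗ {nodes} moved) (sum-addIf (inHead a) (processed T))
          where
          moved : received (addIf (a ==_) (takenIn T)) (takenInt T) ≗ addIf (inHead a ==_) (processed T)
          moved = received-addIf-in (takenIn T) (takenInt T) a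

        step-int : ∀ e → 0 < intCnt C e → Step (process (record C { intCnt = dec e (intCnt C) }) (intHead e))
        step-int e pos = record
          { takenIn  = takenIn T
          ; takenInt = addIf (e ==_) (takenInt T)
          ; inputs   = λ a → trans (cong (_+ _) (process-inCnt _ (intHead e) a)) (inputs T a)
          ; emitted  = emitted-cong (sym ∘ moved) (process-emitted (intHead e) (record
              { internal = λ e′ → trans (dec-addIf e (intCnt C) (takenInt T) pos e′) (Emitted.internal (emitted T) e′)
              ; outputs = Emitted.outputs (emitted T) ; states = Emitted.states (emitted T) }))
          ; bounded  = λ w → subst (_≤ L w) (sym (moved w)) (addIf-bounded (intHead e) (pending-int-< e pos) (bounded T) w)
          } , trans (sum-cong-≗ {nodes} moved) (sum-addIf (intHead e) (processed T))
          where
          moved : received (takenIn T) (addIf (e ==_) (takenInt T)) ≗ addIf (intHead e ==_) (processed T)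
          moved = received-addIf-int (takenIn T) (takenInt T) e

      data Pending (C : Config) : Set where
        halted   : Halted C → Pending C
        input    : ∀ a → 0 < inCnt C a → Pending C
        internal : ∀ e → 0 < intCnt C e → Pending C

      pending? : ∀ C → Pending C
      pending? C with any? (λ a → 0 <? inCnt C a) | any? (λ e → 0 <? intCnt C e)
      ... | yes (a , pos) | _             = input a pos
      ... | no _          | yes (e , pos) = internal e pos
      ... | no noIn       | no noInt      =
        halted ((λ a → n≤0⇒n≡0 (≮⇒≥ (λ pos → noIn (a , pos)))) ,
                (λ e → n≤0⇒n≡0 (≮⇒≥ (λ pos → noInt (e , pos)))))

      -- with nothing pending the processed counts solve the balance equations, so they are L
      halted-outputs : ∀ {C} (T : Tracked C) → Halted C → ∀ b → outCnt C b ≡ output L b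
      halted-outputs {C} T (noIn , noInt) b =
        trans (Emitted.outputs (emitted T) b) (output-cong (consistent-unique sorted processedConsistent consistent) b)
        where
        processedConsistent : Consistent x (processed T)
        processedConsistent v = cong₂ _+_
          (fiberSum-cong (just ∘ inHead) v (λ a _ → trans (cong (_+ takenIn T a) (sym (noIn a))) (inputs T a)))
          (fiberSum-cong (just ∘ intHead) v (λ e _ → trans (cong (_+ takenInt T e) (sym (noInt e))) (Emitted.internal (emitted T) e)))

      Outcome : Config → Set
      Outcome C = Σ Config λ C′ → Run C C′ × Halted C′ × (∀ b → outCnt C′ b ≡ output L b)

      -- each step raises ∑ processed by one and keeps processed ≤ L, so ∑ L steps suffice
      drain : ∀ fuel {C} (T : Tracked C) → sum (processed T) + fuel ≡ sum L → Outcome C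
      advance : ∀ fuel {C C′} (T : Tracked C) → Step T C′ → (∀ {C″} → Run C′ C″ → Run C C″) →
                sum (processed T) + fuel ≡ sum L → Outcome C

      drain fuel {C} T budget with pending? C
      ... | halted h       = C , done , h , halted-outputs T h
      ... | input a pos    = advance fuel T (step-in T a pos) (fromIn a pos) budget
      ... | internal e pos = advance fuel T (step-int T e pos) (fromInt e pos) budget

      advance zero T (T′ , grew) _ budget = ⊥-elim (<-irrefl refl (begin-strict
        sum (processed T)       <⟨ n<1+n _ ⟩
        suc (sum (processed T)) ≡⟨ grew ⟨
        sum (processed T′)      ≤⟨ sum-mono-≤ (bounded T′) ⟩
        sum L                   ≡⟨ budget ⟨
        sum (processed T) + 0   ≡⟨ +-identityʳ _ ⟩
        sum (processed T)       ∎))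
        where open ≤-Reasoning
      advance (suc fuel) T (T′ , grew) prefix budget
        with drain fuel T′ (trans (cong (_+ fuel) grew) (trans (sym (+-suc _ fuel)) budget))
      ... | C″ , run , h , out = C″ , prefix run , h , out

      nothing-taken : received (λ _ → 0) (λ _ → 0) ≗ (λ _ → 0)
      nothing-taken v = cong₂ _+_ (fiberSum-zero (just ∘ inHead) v) (fiberSum-zero (just ∘ intHead) v)

      initial : Tracked (initConfig x)
      initial = record
        { takenIn  = λ _ → 0
        ; takenInt = λ _ → 0
        ; inputs   = λ a → +-identityʳ (x a)
        ; emitted  = emitted-cong (sym ∘ nothing-taken) (record
            { internal = λ e → refl ; outputs = noOutput ; states = λ v → refl })
        ; bounded  = λ v → subst (_≤ L v) (sym (nothing-taken v)) z≤n
        }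
        where
        noOutput : ∀ b → 0 ≡ output (λ _ → 0) b
        noOutput b with outTail b
        ... | nothing = refl
        ... | just _  = refl

      halts : HaltsWith x (output L)
      halts = drain (sum L) initial
        (cong (_+ sum L) (trans (sum-cong-≗ {nodes} nothing-taken) (sum-replicate-zero nodes)))

    sorted-halts : Sorted → ∀ {x L} → Consistent x L → HaltsWith x (output L)
    sorted-halts sorted {x} {L} con = Execution.halts x L sorted con

module Composition where

  open import Data.Nat using (ℕ; zero; suc; _+_; _<_)
  open import Data.Nat.Properties hiding (_≟_; suc-injective)
  open import Data.Bool using (false; if_then_else_)
  open import Data.Fin using (Fin; zero; suc; toℕ; _↑ˡ_; _↑ʳ_; _≟_)
  open import Data.Fin.Properties using (toℕ<n; toℕ-↑ˡ; toℕ-↑ʳ; ↑ˡ-injective; ↑ʳ-injective; suc-injective)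
  open import Data.Maybe using (Maybe; just; nothing; maybe′)
  import Data.Maybe as Maybe
  open import Data.Product using (Σ; _×_; _,_; proj₁; proj₂)
  open import Data.Vec.Functional using (_++_)
  open import Data.Vec.Functional.Properties using (lookup-++ˡ; lookup-++ʳ; ++-cong)
  open import Function using (_∘_)
  open import Relation.Nullary using (yes; no)
  open import Relation.Binary.PropositionalEquality
  open import Algebra.Properties.CommutativeMonoid.Sum +-0-commutativeMonoid
    using (sum; sum-cong-≗; sum-replicate-zero)
  open Networks

  sum-++ : ∀ {m n} (g : Fin (m + n) → ℕ) → sum g ≡ sum (g ∘ (_↑ˡ n)) + sum (g ∘ (m ↑ʳ_))
  sum-++ {zero}  g = refl
  sum-++ {suc m} {n} g = trans (cong (g zero +_) (sum-++ {m} {n} (g ∘ suc))) (sym (+-assoc (g zero) _ _))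

  ↑ˡ≢↑ʳ : ∀ {m n} (i : Fin m) (j : Fin n) → i ↑ˡ n ≢ m ↑ʳ j
  ↑ˡ≢↑ʳ zero    j ()
  ↑ˡ≢↑ʳ (suc i) j eq = ↑ˡ≢↑ʳ i j (suc-injective eq)

  module _ {m n} (h : Fin m → Maybe (Fin n)) where

    fiberSum-map-injective : ∀ {k} (φ : Fin n → Fin k) → (∀ u w → φ u ≡ φ w → u ≡ w) →
                             ∀ v f → fiberSum (Maybe.map φ ∘ h) (φ v) f ≡ fiberSum h v f
    fiberSum-map-injective φ injective v f = sum-cong-≗ {m} λ e → cong (λ b → if b then f e else 0) (atNode-map (h e))
      where
      atNode-map : ∀ u → atNode (Maybe.map φ u) (φ v) ≡ atNode u v
      atNode-map nothing  = refl
      atNode-map (just u) with u ≟ v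
      ... | yes refl = ==-refl (φ u)
      ... | no u≢v   = ==-false (u≢v ∘ injective u v)

    fiberSum-map-disjoint : ∀ {k} (φ : Fin n → Fin k) w → (∀ u → φ u ≢ w) → ∀ f → fiberSum (Maybe.map φ ∘ h) w f ≡ 0
    fiberSum-map-disjoint φ w missed f =
      trans (sum-cong-≗ {m} λ e → cong (λ b → if b then f e else 0) (atNode-map (h e))) (sum-replicate-zero m)
      where
      atNode-map : ∀ u → atNode (Maybe.map φ u) w ≡ false
      atNode-map nothing  = refl
      atNode-map (just u) = ==-false (missed u)

  fiberSum-split : ∀ {m₁ m₂ n} (h : Fin (m₁ + m₂) → Maybe (Fin n)) h₁ h₂ →
                   (∀ e → h (e ↑ˡ m₂) ≡ h₁ e) → (∀ e → h (m₁ ↑ʳ e) ≡ h₂ e) →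
                   ∀ v f → fiberSum h v f ≡ fiberSum h₁ v (f ∘ (_↑ˡ m₂)) + fiberSum h₂ v (f ∘ (m₁ ↑ʳ_))
  fiberSum-split {m₁} {m₂} h h₁ h₂ onLeft onRight v f = trans (sum-++ {m₁} {m₂} _)
    (cong₂ _+_ (sum-cong-≗ {m₁} λ e → cong (λ u → if atNode u v then f (e ↑ˡ m₂) else 0) (onLeft e))
               (sum-cong-≗ {m₂} λ e → cong (λ u → if atNode u v then f (m₁ ↑ʳ e) else 0) (onRight e)))

  fiberSum-just : ∀ {n} v (f : Fin n → ℕ) → fiberSum just v f ≡ f v
  fiberSum-just {n} v f = trans (sum-cong-≗ {n} λ k → cong (λ b → if b then f k else 0) (==-sym k v)) (sum-δ v f)

  data Split (m n : ℕ) : Fin (m + n) → Set where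
    left  : ∀ i → Split m n (i ↑ˡ n)
    right : ∀ j → Split m n (m ↑ʳ j)

  split : ∀ m n k → Split m n k
  split zero    n k       = right k
  split (suc m) n zero    = left zero
  split (suc m) n (suc k) with split m n k
  ... | left i  = left (suc i)
  ... | right j = right j

  module Juxtaposed {n₁ n₂ : ℕ} where

    ι₁ : Fin n₁ → Fin (n₁ + n₂)
    ι₁ = _↑ˡ n₂

    ι₂ : Fin n₂ → Fin (n₁ + n₂)
    ι₂ = n₁ ↑ʳ_

    ι₁-< : ∀ {u w} → toℕ u < toℕ w → toℕ (ι₁ u) < toℕ (ι₁ w)
    ι₁-< {u} {w} = subst₂ _<_ (sym (toℕ-↑ˡ u n₂)) (sym (toℕ-↑ˡ w n₂))

    ι₂-< : ∀ {u w} → toℕ u < toℕ w → toℕ (ι₂ u) < toℕ (ι₂ w)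
    ι₂-< {u} {w} u<w = subst₂ _<_ (sym (toℕ-↑ʳ n₁ u)) (sym (toℕ-↑ʳ n₁ w)) (+-monoʳ-< n₁ u<w)

    ι₁<ι₂ : ∀ u w → toℕ (ι₁ u) < toℕ (ι₂ w)
    ι₁<ι₂ u w = subst₂ _<_ (sym (toℕ-↑ˡ u n₂)) (sym (toℕ-↑ʳ n₁ w)) (<-≤-trans (toℕ<n u) (m≤m+n n₁ (toℕ w)))

    emittedAfter-++ˡ : ∀ (g₁ : Fin n₁ → Gate) (g₂ : Fin n₂ → Gate) (L₁ : Fin n₁ → ℕ) (L₂ : Fin n₂ → ℕ) u →
                       emittedAfter ((g₁ ++ g₂) (ι₁ u)) ((L₁ ++ L₂) (ι₁ u)) ≡ emittedAfter (g₁ u) (L₁ u)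
    emittedAfter-++ˡ g₁ g₂ L₁ L₂ u = cong₂ emittedAfter (lookup-++ˡ g₁ g₂ u) (lookup-++ˡ L₁ L₂ u)

    emittedAfter-++ʳ : ∀ (g₁ : Fin n₁ → Gate) (g₂ : Fin n₂ → Gate) (L₁ : Fin n₁ → ℕ) (L₂ : Fin n₂ → ℕ) u →
                       emittedAfter ((g₁ ++ g₂) (ι₂ u)) ((L₁ ++ L₂) (ι₂ u)) ≡ emittedAfter (g₂ u) (L₂ u)
    emittedAfter-++ʳ g₁ g₂ L₁ L₂ u = cong₂ emittedAfter (lookup-++ʳ g₁ g₂ u) (lookup-++ʳ L₁ L₂ u)

    module _ {m₁ m₂ : ℕ} (h : Fin (m₁ + m₂) → Maybe (Fin (n₁ + n₂)))
             (h₁ : Fin m₁ → Maybe (Fin n₁)) (h₂ : Fin m₂ → Maybe (Fin n₂))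
             (onLeft : ∀ e → h (e ↑ˡ m₂) ≡ Maybe.map ι₁ (h₁ e))
             (onRight : ∀ e → h (m₁ ↑ʳ e) ≡ Maybe.map ι₂ (h₂ e)) where

      fiberSum-blockˡ : ∀ i f → fiberSum h (ι₁ i) f ≡ fiberSum h₁ i (f ∘ (_↑ˡ m₂))
      fiberSum-blockˡ i f = begin
        fiberSum h (ι₁ i) f
          ≡⟨ fiberSum-split h _ _ onLeft onRight (ι₁ i) f ⟩
        fiberSum (Maybe.map ι₁ ∘ h₁) (ι₁ i) (f ∘ (_↑ˡ m₂)) + fiberSum (Maybe.map ι₂ ∘ h₂) (ι₁ i) (f ∘ (m₁ ↑ʳ_))
          ≡⟨ cong₂ _+_ (fiberSum-map-injective h₁ ι₁ (↑ˡ-injective n₂) i _)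
                       (fiberSum-map-disjoint h₂ ι₂ (ι₁ i) (λ u eq → ↑ˡ≢↑ʳ i u (sym eq)) _) ⟩
        fiberSum h₁ i (f ∘ (_↑ˡ m₂)) + 0
          ≡⟨ +-identityʳ _ ⟩
        fiberSum h₁ i (f ∘ (_↑ˡ m₂)) ∎
        where open ≡-Reasoning

      fiberSum-blockʳ : ∀ j f → fiberSum h (ι₂ j) f ≡ fiberSum h₂ j (f ∘ (m₁ ↑ʳ_))
      fiberSum-blockʳ j f = trans (fiberSum-split h _ _ onLeft onRight (ι₂ j) f)
        (cong₂ _+_ (fiberSum-map-disjoint h₁ ι₁ (ι₂ j) (λ u → ↑ˡ≢↑ʳ u j) _)
                   (fiberSum-map-injective h₂ ι₂ (↑ʳ-injective n₁) j _))

    module _ {m₁ m₂ : ℕ} (h₁ : Fin m₁ → Fin n₁) (h₂ : Fin m₂ → Fin n₂) where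
      private
        h : Fin (m₁ + m₂) → Fin (n₁ + n₂)
        h = (ι₁ ∘ h₁) ++ (ι₂ ∘ h₂)
        onLeft : ∀ e → just (h (e ↑ˡ m₂)) ≡ just (ι₁ (h₁ e))
        onLeft e = cong just (lookup-++ˡ (ι₁ ∘ h₁) (ι₂ ∘ h₂) e)
        onRight : ∀ e → just (h (m₁ ↑ʳ e)) ≡ just (ι₂ (h₂ e))
        onRight e = cong just (lookup-++ʳ (ι₁ ∘ h₁) (ι₂ ∘ h₂) e)

      fiberSum-++ˡ : ∀ i f → fiberSum (just ∘ h) (ι₁ i) f ≡ fiberSum (just ∘ h₁) i (f ∘ (_↑ˡ m₂))
      fiberSum-++ˡ = fiberSum-blockˡ (just ∘ h) (just ∘ h₁) (just ∘ h₂) onLeft onRight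

      fiberSum-++ʳ : ∀ j f → fiberSum (just ∘ h) (ι₂ j) f ≡ fiberSum (just ∘ h₂) j (f ∘ (m₁ ↑ʳ_))
      fiberSum-++ʳ = fiberSum-blockʳ (just ∘ h) (just ∘ h₁) (just ∘ h₂) onLeft onRight

  maybe′-map : ∀ {A B : Set} {f : B → ℕ} {g : A → ℕ} (φ : A → B) → (∀ u → f (φ u) ≡ g u) →
               ∀ m → maybe′ f 0 (Maybe.map φ m) ≡ maybe′ g 0 m
  maybe′-map φ f∘φ≗g nothing  = refl
  maybe′-map φ f∘φ≗g (just u) = f∘φ≗g u

  arity-transfer : ∀ {a b a′ b′} {N : Network a b} {M : Network a′ b′} {v w} →
    Semantics.inEdges N v ≡ Semantics.inEdges M w → Semantics.outEdges N v ≡ Semantics.outEdges M w →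
    Network.gate N v ≡ Network.gate M w → Semantics.ArityAt M w → Semantics.ArityAt N v
  arity-transfer ins outs gates (in≡ , out≡) =
    trans ins (trans in≡ (cong inArity (sym gates))) , trans outs (trans out≡ (cong outArity (sym gates)))

  record Implements {a b : ℕ} (N : Network a b) (f : (Fin a → ℕ) → Fin b → ℕ) : Set where
    field
      wellFormed : WellFormed N
      sorted     : Semantics.Sorted N
      labelling  : ∀ x → Σ (Fin (Network.nodes N) → ℕ) λ L → Semantics.Consistent N x L × Semantics.output N L ≗ f x

  Attached : ∀ {a b} → Network a b → Set
  Attached {b = b} N = Σ (Fin b → Fin (Network.nodes N)) λ tail → ∀ j → Network.outTail N j ≡ just (tail j)

  implements-cong : ∀ {a b} {N : Network a b} {f g} → Implements N f → (∀ x → f x ≗ g x) → Implements N g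
  implements-cong I f≗g = record
    { wellFormed = Implements.wellFormed I
    ; sorted     = Implements.sorted I
    ; labelling  = λ x → let (L , con , out) = Implements.labelling I x in L , con , λ j → trans (out j) (f≗g x j)
    }

  module Parallel {a₁ b₁ a₂ b₂} (N₁ : Network a₁ b₁) (N₂ : Network a₂ b₂) where
    private
      module N1 = Network N₁
      module N2 = Network N₂
      module S1 = Semantics N₁
      module S2 = Semantics N₂
    open Juxtaposed {N1.nodes} {N2.nodes}

    net : Network (a₁ + a₂) (b₁ + b₂)
    net = record
      { nodes     = N1.nodes + N2.nodes
      ; gate      = N1.gate ++ N2.gate
      ; nInt      = N1.nInt + N2.nInt
      ; nTrash    = N1.nTrash + N2.nTrash
      ; inHead    = (ι₁ ∘ N1.inHead) ++ (ι₂ ∘ N2.inHead)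
      ; intTail   = (ι₁ ∘ N1.intTail) ++ (ι₂ ∘ N2.intTail)
      ; intHead   = (ι₁ ∘ N1.intHead) ++ (ι₂ ∘ N2.intHead)
      ; outTail   = (Maybe.map ι₁ ∘ N1.outTail) ++ (Maybe.map ι₂ ∘ N2.outTail)
      ; trashTail = (ι₁ ∘ N1.trashTail) ++ (ι₂ ∘ N2.trashTail)
      }
    open Network net
    open Semantics net

    private
      outˡ : ∀ b → outTail (b ↑ˡ b₂) ≡ Maybe.map ι₁ (N1.outTail b)
      outˡ = lookup-++ˡ (Maybe.map ι₁ ∘ N1.outTail) (Maybe.map ι₂ ∘ N2.outTail)
      outʳ : ∀ b → outTail (b₁ ↑ʳ b) ≡ Maybe.map ι₂ (N2.outTail b)
      outʳ = lookup-++ʳ (Maybe.map ι₁ ∘ N1.outTail) (Maybe.map ι₂ ∘ N2.outTail)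

    arities : (∀ v → S1.ArityAt v) → (∀ v → S2.ArityAt v) → ∀ v → ArityAt v
    arities ar₁ ar₂ v with split N1.nodes N2.nodes v
    ... | left i = arity-transfer {N = net} {N₁}
      (cong₂ _+_ (fiberSum-++ˡ N1.inHead N2.inHead i _) (fiberSum-++ˡ N1.intHead N2.intHead i _))
      (cong₂ _+_ (cong₂ _+_ (fiberSum-++ˡ N1.intTail N2.intTail i _) (fiberSum-blockˡ outTail N1.outTail N2.outTail outˡ outʳ i _))
                 (fiberSum-++ˡ N1.trashTail N2.trashTail i _))
      (lookup-++ˡ N1.gate N2.gate i) (ar₁ i)
    ... | right j = arity-transfer {N = net} {N₂}
      (cong₂ _+_ (fiberSum-++ʳ N1.inHead N2.inHead j _) (fiberSum-++ʳ N1.intHead N2.intHead j _))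
      (cong₂ _+_ (cong₂ _+_ (fiberSum-++ʳ N1.intTail N2.intTail j _) (fiberSum-blockʳ outTail N1.outTail N2.outTail outˡ outʳ j _))
                 (fiberSum-++ʳ N1.trashTail N2.trashTail j _))
      (lookup-++ʳ N1.gate N2.gate j) (ar₂ j)

    sorted : S1.Sorted → S2.Sorted → Sorted
    sorted s₁ s₂ e with split N1.nInt N2.nInt e
    ... | left e′  = subst₂ (λ t h → toℕ t < toℕ h) (sym (lookup-++ˡ (ι₁ ∘ N1.intTail) (ι₂ ∘ N2.intTail) e′))
                        (sym (lookup-++ˡ (ι₁ ∘ N1.intHead) (ι₂ ∘ N2.intHead) e′)) (ι₁-< (s₁ e′))
    ... | right e′ = subst₂ (λ t h → toℕ t < toℕ h) (sym (lookup-++ʳ (ι₁ ∘ N1.intTail) (ι₂ ∘ N2.intTail) e′))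
                        (sym (lookup-++ʳ (ι₁ ∘ N1.intHead) (ι₂ ∘ N2.intHead) e′)) (ι₂-< (s₂ e′))

    consistent : ∀ {x x₁ x₂ L₁ L₂} → x ∘ (_↑ˡ a₂) ≗ x₁ → x ∘ (a₁ ↑ʳ_) ≗ x₂ →
                 S1.Consistent x₁ L₁ → S2.Consistent x₂ L₂ → Consistent x (L₁ ++ L₂)
    consistent {x} {x₁} {x₂} {L₁} {L₂} x≗x₁ x≗x₂ con₁ con₂ v with split N1.nodes N2.nodes v
    ... | left i = begin
      (L₁ ++ L₂) (ι₁ i)                                      ≡⟨ lookup-++ˡ L₁ L₂ i ⟩
      L₁ i                                                   ≡⟨ con₁ i ⟩
      S1.received x₁ (S1.emits L₁ ∘ N1.intTail) i            ≡⟨ cong₂ _+_ inputs internal ⟨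
      received x (emits (L₁ ++ L₂) ∘ intTail) (ι₁ i)         ∎
      where
      open ≡-Reasoning
      inputs : fiberSum (just ∘ inHead) (ι₁ i) x ≡ fiberSum (just ∘ N1.inHead) i x₁
      inputs = trans (fiberSum-++ˡ N1.inHead N2.inHead i x) (fiberSum-cong (just ∘ N1.inHead) i (λ a _ → x≗x₁ a))
      internal : fiberSum (just ∘ intHead) (ι₁ i) (emits (L₁ ++ L₂) ∘ intTail)
               ≡ fiberSum (just ∘ N1.intHead) i (S1.emits L₁ ∘ N1.intTail)
      internal = trans (fiberSum-++ˡ N1.intHead N2.intHead i _) (fiberSum-cong (just ∘ N1.intHead) i λ e _ →
        trans (cong (emits (L₁ ++ L₂)) (lookup-++ˡ (ι₁ ∘ N1.intTail) (ι₂ ∘ N2.intTail) e))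
              (emittedAfter-++ˡ N1.gate N2.gate L₁ L₂ (N1.intTail e)))
    ... | right j = begin
      (L₁ ++ L₂) (ι₂ j)                                      ≡⟨ lookup-++ʳ L₁ L₂ j ⟩
      L₂ j                                                   ≡⟨ con₂ j ⟩
      S2.received x₂ (S2.emits L₂ ∘ N2.intTail) j            ≡⟨ cong₂ _+_ inputs internal ⟨
      received x (emits (L₁ ++ L₂) ∘ intTail) (ι₂ j)         ∎
      where
      open ≡-Reasoning
      inputs : fiberSum (just ∘ inHead) (ι₂ j) x ≡ fiberSum (just ∘ N2.inHead) j x₂
      inputs = trans (fiberSum-++ʳ N1.inHead N2.inHead j x) (fiberSum-cong (just ∘ N2.inHead) j (λ a _ → x≗x₂ a))
      internal : fiberSum (just ∘ intHead) (ι₂ j) (emits (L₁ ++ L₂) ∘ intTail)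
               ≡ fiberSum (just ∘ N2.intHead) j (S2.emits L₂ ∘ N2.intTail)
      internal = trans (fiberSum-++ʳ N1.intHead N2.intHead j _) (fiberSum-cong (just ∘ N2.intHead) j λ e _ →
        trans (cong (emits (L₁ ++ L₂)) (lookup-++ʳ (ι₁ ∘ N1.intTail) (ι₂ ∘ N2.intTail) e))
              (emittedAfter-++ʳ N1.gate N2.gate L₁ L₂ (N2.intTail e)))

    output-++ : ∀ L₁ L₂ → output (L₁ ++ L₂) ≗ S1.output L₁ ++ S2.output L₂
    output-++ L₁ L₂ j with split b₁ b₂ j
    ... | left b  = trans (cong (maybe′ (emits (L₁ ++ L₂)) 0) (outˡ b))
                      (trans (maybe′-map ι₁ (emittedAfter-++ˡ N1.gate N2.gate L₁ L₂) (N1.outTail b))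
                             (sym (lookup-++ˡ (S1.output L₁) (S2.output L₂) b)))
    ... | right b = trans (cong (maybe′ (emits (L₁ ++ L₂)) 0) (outʳ b))
                      (trans (maybe′-map ι₂ (emittedAfter-++ʳ N1.gate N2.gate L₁ L₂) (N2.outTail b))
                             (sym (lookup-++ʳ (S1.output L₁) (S2.output L₂) b)))

    implements : ∀ {f₁ f₂} → Implements N₁ f₁ → Implements N₂ f₂ →
                 Implements net (λ x → f₁ (x ∘ (_↑ˡ a₂)) ++ f₂ (x ∘ (a₁ ↑ʳ_)))
    implements {f₁} {f₂} I₁ I₂ = record
      { wellFormed = arities⇒wellFormed (arities (S1.wellFormed⇒arities (Implements.wellFormed I₁))
                                                 (S2.wellFormed⇒arities (Implements.wellFormed I₂)))
      ; sorted     = sorted (Implements.sorted I₁) (Implements.sorted I₂)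
      ; labelling  = λ x → labelled x (Implements.labelling I₁ (x ∘ (_↑ˡ a₂))) (Implements.labelling I₂ (x ∘ (a₁ ↑ʳ_)))
      }
      where
      labelled : ∀ x → Σ _ (λ L₁ → S1.Consistent (x ∘ (_↑ˡ a₂)) L₁ × S1.output L₁ ≗ f₁ (x ∘ (_↑ˡ a₂))) →
                       Σ _ (λ L₂ → S2.Consistent (x ∘ (a₁ ↑ʳ_)) L₂ × S2.output L₂ ≗ f₂ (x ∘ (a₁ ↑ʳ_))) →
                 Σ _ λ L → Consistent x L × output L ≗ f₁ (x ∘ (_↑ˡ a₂)) ++ f₂ (x ∘ (a₁ ↑ʳ_))
      labelled x (L₁ , con₁ , out₁) (L₂ , con₂ , out₂) =
        L₁ ++ L₂ , consistent (λ _ → refl) (λ _ → refl) con₁ con₂ ,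
        λ j → trans (output-++ L₁ L₂ j) (++-cong (S1.output L₁) (f₁ (x ∘ (_↑ˡ a₂))) out₁ out₂ j)

    attached : Attached N₁ → Attached N₂ → Attached net
    attached (t₁ , out₁) (t₂ , out₂) = (ι₁ ∘ t₁) ++ (ι₂ ∘ t₂) , λ j → attachedAt j
      where
      attachedAt : ∀ j → outTail j ≡ just (((ι₁ ∘ t₁) ++ (ι₂ ∘ t₂)) j)
      attachedAt j with split b₁ b₂ j
      ... | left b  = trans (outˡ b) (trans (cong (Maybe.map ι₁) (out₁ b)) (cong just (sym (lookup-++ˡ (ι₁ ∘ t₁) (ι₂ ∘ t₂) b))))
      ... | right b = trans (outʳ b) (trans (cong (Maybe.map ι₂) (out₂ b)) (cong just (sym (lookup-++ʳ (ι₁ ∘ t₁) (ι₂ ∘ t₂) b))))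

  module Serial {a b c} (N₁ : Network a b) (N₂ : Network b c) (attached₁ : Attached N₁) where
    private
      module N1 = Network N₁
      module N2 = Network N₂
      module S1 = Semantics N₁
      module S2 = Semantics N₂
      t₁ : Fin b → Fin N1.nodes
      t₁ = proj₁ attached₁
    open Juxtaposed {N1.nodes} {N2.nodes}

    -- internal edges: those of N₁, then one per output of N₁ (now feeding N₂), then those of N₂
    net : Network a c
    net = record
      { nodes     = N1.nodes + N2.nodes
      ; gate      = N1.gate ++ N2.gate
      ; nInt      = N1.nInt + (b + N2.nInt)
      ; nTrash    = N1.nTrash + N2.nTrash
      ; inHead    = ι₁ ∘ N1.inHead
      ; intTail   = (ι₁ ∘ N1.intTail) ++ ((ι₁ ∘ t₁) ++ (ι₂ ∘ N2.intTail))
      ; intHead   = (ι₁ ∘ N1.intHead) ++ (ι₂ ∘ (N2.inHead ++ N2.intHead))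
      ; outTail   = Maybe.map ι₂ ∘ N2.outTail
      ; trashTail = (ι₁ ∘ N1.trashTail) ++ (ι₂ ∘ N2.trashTail)
      }
    open Network net
    open Semantics net

    private
      tailˡ : ∀ e → intTail (e ↑ˡ (b + N2.nInt)) ≡ ι₁ (N1.intTail e)
      tailˡ = lookup-++ˡ (ι₁ ∘ N1.intTail) ((ι₁ ∘ t₁) ++ (ι₂ ∘ N2.intTail))
      tailᵐ : ∀ k → intTail (N1.nInt ↑ʳ (k ↑ˡ N2.nInt)) ≡ ι₁ (t₁ k)
      tailᵐ k = trans (lookup-++ʳ (ι₁ ∘ N1.intTail) ((ι₁ ∘ t₁) ++ (ι₂ ∘ N2.intTail)) (k ↑ˡ N2.nInt))
                      (lookup-++ˡ (ι₁ ∘ t₁) (ι₂ ∘ N2.intTail) k)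
      tailʳ : ∀ e → intTail (N1.nInt ↑ʳ (b ↑ʳ e)) ≡ ι₂ (N2.intTail e)
      tailʳ e = trans (lookup-++ʳ (ι₁ ∘ N1.intTail) ((ι₁ ∘ t₁) ++ (ι₂ ∘ N2.intTail)) (b ↑ʳ e))
                      (lookup-++ʳ (ι₁ ∘ t₁) (ι₂ ∘ N2.intTail) e)
      headˡ : ∀ e → intHead (e ↑ˡ (b + N2.nInt)) ≡ ι₁ (N1.intHead e)
      headˡ = lookup-++ˡ (ι₁ ∘ N1.intHead) (ι₂ ∘ (N2.inHead ++ N2.intHead))
      headᵐ : ∀ k → intHead (N1.nInt ↑ʳ (k ↑ˡ N2.nInt)) ≡ ι₂ (N2.inHead k)
      headᵐ k = trans (lookup-++ʳ (ι₁ ∘ N1.intHead) (ι₂ ∘ (N2.inHead ++ N2.intHead)) (k ↑ˡ N2.nInt))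
                      (cong ι₂ (lookup-++ˡ N2.inHead N2.intHead k))
      headʳ : ∀ e → intHead (N1.nInt ↑ʳ (b ↑ʳ e)) ≡ ι₂ (N2.intHead e)
      headʳ e = trans (lookup-++ʳ (ι₁ ∘ N1.intHead) (ι₂ ∘ (N2.inHead ++ N2.intHead)) (b ↑ʳ e))
                      (cong ι₂ (lookup-++ʳ N2.inHead N2.intHead e))

      into₂ : ∀ j f → fiberSum (just ∘ intHead) (ι₂ j) f
                    ≡ fiberSum (just ∘ N2.inHead) j (f ∘ (N1.nInt ↑ʳ_) ∘ (_↑ˡ N2.nInt))
                      + fiberSum (just ∘ N2.intHead) j (f ∘ (N1.nInt ↑ʳ_) ∘ (b ↑ʳ_))
      into₂ j f = trans (fiberSum-++ʳ N1.intHead (N2.inHead ++ N2.intHead) j f)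
        (fiberSum-split (just ∘ (N2.inHead ++ N2.intHead)) _ _ (cong just ∘ lookup-++ˡ N2.inHead N2.intHead)
                        (cong just ∘ lookup-++ʳ N2.inHead N2.intHead) j _)

      outOf : ∀ v f → fiberSum (just ∘ intTail) v f
                    ≡ fiberSum (just ∘ ι₁ ∘ N1.intTail) v (f ∘ (_↑ˡ (b + N2.nInt)))
                      + fiberSum (just ∘ ((ι₁ ∘ t₁) ++ (ι₂ ∘ N2.intTail))) v (f ∘ (N1.nInt ↑ʳ_))
      outOf = fiberSum-split (just ∘ intTail) _ _ (cong just ∘ tailˡ)
                (cong just ∘ lookup-++ʳ (ι₁ ∘ N1.intTail) ((ι₁ ∘ t₁) ++ (ι₂ ∘ N2.intTail)))

    arities : (∀ v → S1.ArityAt v) → (∀ v → S2.ArityAt v) → ∀ v → ArityAt v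
    arities ar₁ ar₂ v with split N1.nodes N2.nodes v
    ... | left i = arity-transfer {N = net} {N₁}
      (cong₂ _+_ (fiberSum-map-injective (just ∘ N1.inHead) ι₁ (↑ˡ-injective N2.nodes) i _)
                 (fiberSum-++ˡ N1.intHead (N2.inHead ++ N2.intHead) i _))
      (cong₂ _+_ (trans (cong₂ _+_ internal (fiberSum-map-disjoint N2.outTail ι₂ (ι₁ i) (λ u eq → ↑ˡ≢↑ʳ i u (sym eq)) _))
                        (+-identityʳ _))
                 (fiberSum-++ˡ N1.trashTail N2.trashTail i _))
      (lookup-++ˡ N1.gate N2.gate i) (ar₁ i)
      where
      internal : fiberSum (just ∘ intTail) (ι₁ i) (λ _ → 1)
               ≡ fiberSum (just ∘ N1.intTail) i (λ _ → 1) + fiberSum N1.outTail i (λ _ → 1)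
      internal = trans (outOf (ι₁ i) _) (cong₂ _+_
        (fiberSum-map-injective (just ∘ N1.intTail) ι₁ (↑ˡ-injective N2.nodes) i _)
        (trans (fiberSum-++ˡ t₁ N2.intTail i _) (fiberSum-cong-map (just ∘ t₁) i (sym ∘ proj₂ attached₁) _)))
    ... | right j = arity-transfer {N = net} {N₂}
      (cong₂ _+_ (fiberSum-map-disjoint (just ∘ N1.inHead) ι₁ (ι₂ j) (λ u → ↑ˡ≢↑ʳ u j) _) (into₂ j _))
      (cong₂ _+_ (cong₂ _+_ internal (fiberSum-map-injective N2.outTail ι₂ (↑ʳ-injective N1.nodes) j _))
                 (fiberSum-++ʳ N1.trashTail N2.trashTail j _))
      (lookup-++ʳ N1.gate N2.gate j) (ar₂ j)
      where
      internal : fiberSum (just ∘ intTail) (ι₂ j) (λ _ → 1) ≡ fiberSum (just ∘ N2.intTail) j (λ _ → 1)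
      internal = trans (outOf (ι₂ j) _) (cong₂ _+_
        (fiberSum-map-disjoint (just ∘ N1.intTail) ι₁ (ι₂ j) (λ u → ↑ˡ≢↑ʳ u j) _)
        (fiberSum-++ʳ t₁ N2.intTail j _))

    sorted : S1.Sorted → S2.Sorted → Sorted
    sorted s₁ s₂ e with split N1.nInt (b + N2.nInt) e
    ... | left e′ = subst₂ (λ t h → toℕ t < toℕ h) (sym (tailˡ e′)) (sym (headˡ e′)) (ι₁-< (s₁ e′))
    ... | right e″ with split b N2.nInt e″
    ...   | left k   = subst₂ (λ t h → toℕ t < toℕ h) (sym (tailᵐ k)) (sym (headᵐ k)) (ι₁<ι₂ (t₁ k) (N2.inHead k))
    ...   | right e′ = subst₂ (λ t h → toℕ t < toℕ h) (sym (tailʳ e′)) (sym (headʳ e′)) (ι₂-< (s₂ e′))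

    consistent : ∀ {x y L₁ L₂} → S1.Consistent x L₁ → S1.output L₁ ≗ y → S2.Consistent y L₂ → Consistent x (L₁ ++ L₂)
    consistent {x} {y} {L₁} {L₂} con₁ out₁ con₂ v with split N1.nodes N2.nodes v
    ... | left i = begin
      (L₁ ++ L₂) (ι₁ i)                                ≡⟨ lookup-++ˡ L₁ L₂ i ⟩
      L₁ i                                             ≡⟨ con₁ i ⟩
      S1.received x (S1.emits L₁ ∘ N1.intTail) i       ≡⟨ cong₂ _+_ inputs internal ⟨
      received x (emits (L₁ ++ L₂) ∘ intTail) (ι₁ i)   ∎
      where
      open ≡-Reasoning
      inputs : fiberSum (just ∘ inHead) (ι₁ i) x ≡ fiberSum (just ∘ N1.inHead) i x
      inputs = fiberSum-map-injective (just ∘ N1.inHead) ι₁ (↑ˡ-injective N2.nodes) i x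
      internal : fiberSum (just ∘ intHead) (ι₁ i) (emits (L₁ ++ L₂) ∘ intTail)
               ≡ fiberSum (just ∘ N1.intHead) i (S1.emits L₁ ∘ N1.intTail)
      internal = trans (fiberSum-++ˡ N1.intHead (N2.inHead ++ N2.intHead) i _) (fiberSum-cong (just ∘ N1.intHead) i λ e _ →
        trans (cong (emits (L₁ ++ L₂)) (tailˡ e)) (emittedAfter-++ˡ N1.gate N2.gate L₁ L₂ (N1.intTail e)))
    ... | right j = begin
      (L₁ ++ L₂) (ι₂ j)                                ≡⟨ lookup-++ʳ L₁ L₂ j ⟩
      L₂ j                                             ≡⟨ con₂ j ⟩
      S2.received y (S2.emits L₂ ∘ N2.intTail) j
        ≡⟨ cong₂ _+_ (fiberSum-map-disjoint (just ∘ N1.inHead) ι₁ (ι₂ j) (λ u → ↑ˡ≢↑ʳ u j) x)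
                     (trans (into₂ j _) (cong₂ _+_ fromN₁ internal)) ⟨
      received x (emits (L₁ ++ L₂) ∘ intTail) (ι₂ j)   ∎
      where
      open ≡-Reasoning
      fromN₁ : fiberSum (just ∘ N2.inHead) j (emits (L₁ ++ L₂) ∘ intTail ∘ (N1.nInt ↑ʳ_) ∘ (_↑ˡ N2.nInt))
             ≡ fiberSum (just ∘ N2.inHead) j y
      fromN₁ = fiberSum-cong (just ∘ N2.inHead) j λ k _ → begin
        emits (L₁ ++ L₂) (intTail (N1.nInt ↑ʳ (k ↑ˡ N2.nInt))) ≡⟨ cong (emits (L₁ ++ L₂)) (tailᵐ k) ⟩
        emits (L₁ ++ L₂) (ι₁ (t₁ k))                          ≡⟨ emittedAfter-++ˡ N1.gate N2.gate L₁ L₂ (t₁ k) ⟩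
        S1.emits L₁ (t₁ k)                                    ≡⟨ cong (maybe′ (S1.emits L₁) 0) (proj₂ attached₁ k) ⟨
        S1.output L₁ k                                        ≡⟨ out₁ k ⟩
        y k                                                   ∎
      internal : fiberSum (just ∘ N2.intHead) j (emits (L₁ ++ L₂) ∘ intTail ∘ (N1.nInt ↑ʳ_) ∘ (b ↑ʳ_))
               ≡ fiberSum (just ∘ N2.intHead) j (S2.emits L₂ ∘ N2.intTail)
      internal = fiberSum-cong (just ∘ N2.intHead) j λ e _ →
        trans (cong (emits (L₁ ++ L₂)) (tailʳ e)) (emittedAfter-++ʳ N1.gate N2.gate L₁ L₂ (N2.intTail e))

    output-++ : ∀ L₁ L₂ → output (L₁ ++ L₂) ≗ S2.output L₂
    output-++ L₁ L₂ j = maybe′-map ι₂ (emittedAfter-++ʳ N1.gate N2.gate L₁ L₂) (N2.outTail j)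

    implements : ∀ {f₁ f₂} → Implements N₁ f₁ → Implements N₂ f₂ → Implements net (f₂ ∘ f₁)
    implements {f₁} {f₂} I₁ I₂ = record
      { wellFormed = arities⇒wellFormed (arities (S1.wellFormed⇒arities (Implements.wellFormed I₁))
                                                 (S2.wellFormed⇒arities (Implements.wellFormed I₂)))
      ; sorted     = sorted (Implements.sorted I₁) (Implements.sorted I₂)
      ; labelling  = λ x → labelled x (Implements.labelling I₁ x) (Implements.labelling I₂ (f₁ x))
      }
      where
      labelled : ∀ x → Σ _ (λ L₁ → S1.Consistent x L₁ × S1.output L₁ ≗ f₁ x) →
                       Σ _ (λ L₂ → S2.Consistent (f₁ x) L₂ × S2.output L₂ ≗ f₂ (f₁ x)) →
                 Σ _ λ L → Consistent x L × output L ≗ f₂ (f₁ x)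
      labelled x (L₁ , con₁ , out₁) (L₂ , con₂ , out₂) =
        L₁ ++ L₂ , consistent con₁ out₁ con₂ , λ j → trans (output-++ L₁ L₂ j) (out₂ j)

    attached : Attached N₂ → Attached net
    attached (t₂ , out₂) = ι₂ ∘ t₂ , λ j → cong (Maybe.map ι₂) (out₂ j)

module Compilation where

  open import Data.Nat using (ℕ; zero; suc; _+_; _*_; _<_; z≤n; s≤s; z<s; _<ᵇ_)
  open import Data.Nat.Properties hiding (_≟_)
  open import Data.Nat.DivMod
  open import Data.Bool using (true; false; T)
  open import Data.Fin using (Fin; zero; suc; _↑ˡ_; _↑ʳ_)
  open import Data.Maybe using (Maybe; just; nothing)
  open import Data.Product using (Σ; _×_; _,_; proj₁; proj₂)
  open import Data.Unit using (tt)
  open import Function using (_∘_; id)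
  open import Data.Vec.Functional using (_++_)
  open import Data.Vec.Functional.Properties using (lookup-++ˡ; lookup-++ʳ; ++-cong)
  open import Relation.Binary.PropositionalEquality
  open Arithmetic using ([m+kn]/n≡m/n+k)
  open Circuits using (Circuit; input; _⊕_; topple; ⟦_⟧; ⟦_⟧?)
  open Networks
  open Composition
  open import Algebra.Properties.CommutativeMonoid.Sum +-0-commutativeMonoid using (sum)

  module Toppler (d q : ℕ) (q<2+d : q < 2 + d) where

    lam : ℕ
    lam = 2 + d

    gate : Gate
    gate = toppler lam (s≤s (s≤s z≤n)) q q<2+d

    step : ∀ s e f → s < lam → s + e * lam ≡ q + f →
           proj₁ (gateStep gate s) < lam × proj₁ (gateStep gate s) + (e + bit (proj₂ (gateStep gate s))) * lam ≡ q + suc f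
    step s e f s<lam eq with suc s <ᵇ lam in fits
    ... | true  = <ᵇ⇒< (suc s) lam (subst T (sym fits) tt) ,
                  trans (cong (λ k → suc s + k * lam) (+-identityʳ e)) (trans (cong suc eq) (sym (+-suc q f)))
    ... | false = z<s , (begin
      (e + 1) * lam        ≡⟨ *-distribʳ-+ lam e 1 ⟩
      e * lam + 1 * lam    ≡⟨ cong (e * lam +_) (*-identityˡ lam) ⟩
      e * lam + lam        ≡⟨ cong (e * lam +_) wraps ⟨
      e * lam + suc s      ≡⟨ +-suc (e * lam) s ⟩
      suc (e * lam + s)    ≡⟨ cong suc (trans (+-comm (e * lam) s) eq) ⟩
      suc (q + f)          ≡⟨ +-suc q f ⟨
      q + suc f            ∎)
      where
      open ≡-Reasoning
      wraps : suc s ≡ lam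
      wraps = ≤-antisym s<lam (≮⇒≥ (λ 1+s<lam → subst T fits (<⇒<ᵇ 1+s<lam)))

    invariant : ∀ f → stateAfter gate f < lam × stateAfter gate f + emittedAfter gate f * lam ≡ q + f
    invariant zero    = q<2+d , refl
    invariant (suc f) = step (stateAfter gate f) (emittedAfter gate f) f (proj₁ (invariant f)) (proj₂ (invariant f))

    emittedAfter-toppler : ∀ f → emittedAfter gate f ≡ (q + f) / lam
    emittedAfter-toppler f = sym (begin
      (q + f) / lam                       ≡⟨ cong (_/ lam) (proj₂ (invariant f)) ⟨
      (s + emittedAfter gate f * lam) / lam ≡⟨ [m+kn]/n≡m/n+k s (emittedAfter gate f) lam ⟩
      s / lam + emittedAfter gate f       ≡⟨ cong (_+ emittedAfter gate f) (m<n⇒m/n≡0 (proj₁ (invariant f))) ⟩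
      emittedAfter gate f                 ∎)
      where
      open ≡-Reasoning
      s : ℕ
      s = stateAfter gate f

  emittedAfter-id : ∀ g → (∀ s → gateStep g s ≡ (s , true)) → ∀ f → emittedAfter g f ≡ f
  emittedAfter-id g passes zero    = refl
  emittedAfter-id g passes (suc f) = trans (cong₂ _+_ (emittedAfter-id g passes f) (cong (bit ∘ proj₂) (passes _))) (+-comm f 1)

  count-true : ∀ n → count {n} (λ _ → true) ≡ n
  count-true zero    = refl
  count-true (suc n) = cong suc (count-true n)

  single : (g : Gate) (k t : ℕ) → Network (inArity g) k
  single g k t = record
    { nodes = 1 ; gate = λ _ → g ; nInt = 0 ; nTrash = t
    ; inHead = λ _ → zero ; intTail = λ () ; intHead = λ () ; outTail = λ _ → just zero ; trashTail = λ _ → zero }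

  single-implements : ∀ g k t → outArity g ≡ k + t → Implements (single g k t) (λ x _ → emittedAfter g (sum x))
  single-implements g k t arity = record
    { wellFormed = λ { zero → trans (+-identityʳ _) (count-true (inArity g)) , trans (cong₂ _+_ (count-true k) (count-true t)) (sym arity) }
    ; sorted     = λ ()
    ; labelling  = λ x → (λ _ → sum x) , (λ { zero → sym (+-identityʳ _) }) , (λ _ → refl)
    }

  single-attached : ∀ g k t → Attached (single g k t)
  single-attached g k t = (λ _ → zero) , (λ _ → refl)

  adder-implements : Implements (single adder 1 0) (λ x _ → x zero + x (suc zero))
  adder-implements = implements-cong (single-implements adder 1 0 refl)
    (λ x _ → trans (emittedAfter-id adder (λ _ → refl) _) (cong (x zero +_) (+-identityʳ _)))

  wire : Network 1 1
  wire = single splitter 1 1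

  wire-implements : Implements wire (λ x _ → x zero)
  wire-implements = implements-cong (single-implements splitter 1 1 refl)
    (λ x _ → trans (emittedAfter-id splitter (λ _ → refl) _) (+-identityʳ _))

  sink : Network 1 0
  sink = single splitter 0 2

  sink-implements : Implements sink (λ _ ())
  sink-implements = implements-cong (single-implements splitter 0 2 refl) (λ _ ())

  toppler-implements : ∀ d q q<2+d → Implements (single (Toppler.gate d q q<2+d) 1 0) (λ x _ → (x zero + q) / (2 + d))
  toppler-implements d q q<2+d = implements-cong (single-implements (Toppler.gate d q q<2+d) 1 0 refl)
    (λ x _ → trans (Toppler.emittedAfter-toppler d q q<2+d (x zero + 0))
                   (cong (_/ (2 + d)) (trans (+-comm q _) (cong (_+ q) (+-identityʳ (x zero))))))

  empty : Network 0 0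
  empty = record
    { nodes = 0 ; gate = λ () ; nInt = 0 ; nTrash = 0
    ; inHead = λ () ; intTail = λ () ; intHead = λ () ; outTail = λ () ; trashTail = λ () }

  empty-implements : Implements empty (λ _ ())
  empty-implements = record { wellFormed = λ () ; sorted = λ () ; labelling = λ x → (λ ()) , (λ ()) , (λ ()) }

  unattached : Network 0 1
  unattached = record
    { nodes = 0 ; gate = λ () ; nInt = 0 ; nTrash = 0
    ; inHead = λ () ; intTail = λ () ; intHead = λ () ; outTail = λ _ → nothing ; trashTail = λ () }

  unattached-implements : Implements unattached (λ _ _ → 0)
  unattached-implements = record { wellFormed = λ () ; sorted = λ () ; labelling = λ x → (λ ()) , (λ ()) , (λ _ → refl) }

  duplicate : ∀ n → Network n (n + n)
  duplicate n = record
    { nodes = n ; gate = λ _ → splitter ; nInt = 0 ; nTrash = 0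
    ; inHead = id ; intTail = λ () ; intHead = λ () ; outTail = just ∘ (id ++ id) ; trashTail = λ () }

  duplicate-attached : ∀ n → Attached (duplicate n)
  duplicate-attached n = id ++ id , λ _ → refl

  duplicate-implements : ∀ n → Implements (duplicate n) (λ x → x ++ x)
  duplicate-implements n = record
    { wellFormed = arities⇒wellFormed λ v →
        trans (+-identityʳ _) (fiberSum-just v _) ,
        trans (+-identityʳ _) (trans (fiberSum-split (just ∘ (id ++ id)) just just (cong just ∘ lookup-++ˡ id id)
                                                     (cong just ∘ lookup-++ʳ id id) v _)
                                     (cong₂ _+_ (fiberSum-just v _) (fiberSum-just v _)))
    ; sorted     = λ ()
    ; labelling  = λ x → x , (λ v → sym (trans (+-identityʳ _) (fiberSum-just v x))) , copies x
    }
    where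
    open Semantics (duplicate n)
    copies : ∀ x → output x ≗ x ++ x
    copies x o with split n n o
    ... | left i  = trans (emittedAfter-id splitter (λ _ → refl) _) (trans (cong x (lookup-++ˡ id id i)) (sym (lookup-++ˡ x x i)))
    ... | right i = trans (emittedAfter-id splitter (λ _ → refl) _) (trans (cong x (lookup-++ʳ id id i)) (sym (lookup-++ʳ x x i)))

  sinks : ∀ n → Network n 0
  sinks zero    = empty
  sinks (suc n) = Parallel.net sink (sinks n)

  sinks-implements : ∀ n → Implements (sinks n) (λ _ ())
  sinks-implements zero    = empty-implements
  sinks-implements (suc n) = implements-cong (Parallel.implements sink (sinks n) sink-implements (sinks-implements n)) (λ _ ())

  select : ∀ {n} → Fin n → Network n 1
  select {suc n} zero    = Parallel.net wire (sinks n)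
  select {suc n} (suc i) = Parallel.net sink (select i)

  select-implements : ∀ {n} (i : Fin n) → Implements (select i) (λ x _ → x i)
  select-implements {suc n} zero    = implements-cong (Parallel.implements wire (sinks n) wire-implements (sinks-implements n))
                                                      (λ { x zero → refl })
  select-implements {suc n} (suc i) = implements-cong (Parallel.implements sink (select i) sink-implements (select-implements i))
                                                      (λ { x zero → refl })

  select-attached : ∀ {n} (i : Fin n) → Attached (select i)
  select-attached {suc n} zero    = Parallel.attached wire (sinks n) (single-attached splitter 1 1) ((λ ()) , (λ ()))
  select-attached {suc n} (suc i) = Parallel.attached sink (select i) ((λ ()) , (λ ())) (select-attached i)

  fork : ∀ {n b₁ b₂} → Network n b₁ → Network n b₂ → Network n (b₁ + b₂)
  fork {n} N₁ N₂ = Serial.net (duplicate n) (Parallel.net N₁ N₂) (duplicate-attached n)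

  fork-attached : ∀ {n b₁ b₂} (N₁ : Network n b₁) (N₂ : Network n b₂) → Attached N₁ → Attached N₂ → Attached (fork N₁ N₂)
  fork-attached {n} N₁ N₂ A₁ A₂ =
    Serial.attached (duplicate n) (Parallel.net N₁ N₂) (duplicate-attached n) (Parallel.attached N₁ N₂ A₁ A₂)

  fork-implements : ∀ {n b₁ b₂} {N₁ : Network n b₁} {N₂ : Network n b₂} {f₁ f₂} →
                    Implements N₁ f₁ → Implements N₂ f₂ → Implements (fork N₁ N₂) (λ x → f₁ x ++ f₂ x)
  fork-implements {n} {N₁ = N₁} {N₂} {f₁} {f₂} I₁ I₂ = record
    { wellFormed = Implements.wellFormed whole
    ; sorted     = Implements.sorted whole
    ; labelling  = λ x → labelled x (Implements.labelling (duplicate-implements n) x) (Implements.labelling I₁ x) (Implements.labelling I₂ x)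
    }
    where
    module Fan = Serial (duplicate n) (Parallel.net N₁ N₂) (duplicate-attached n)
    module Both = Parallel N₁ N₂
    whole : Implements (fork N₁ N₂) (λ x → f₁ ((x ++ x) ∘ (_↑ˡ n)) ++ f₂ ((x ++ x) ∘ (n ↑ʳ_)))
    whole = Fan.implements (duplicate-implements n) (Both.implements I₁ I₂)
    -- labellings are combined directly, since f₁ and f₂ need not respect pointwise equality of inputs
    labelled : ∀ x → Σ _ (λ L₀ → Semantics.Consistent (duplicate n) x L₀ × Semantics.output (duplicate n) L₀ ≗ x ++ x) →
               Σ _ (λ L₁ → Semantics.Consistent N₁ x L₁ × Semantics.output N₁ L₁ ≗ f₁ x) →
               Σ _ (λ L₂ → Semantics.Consistent N₂ x L₂ × Semantics.output N₂ L₂ ≗ f₂ x) →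
               Σ _ λ L → Semantics.Consistent (fork N₁ N₂) x L × Semantics.output (fork N₁ N₂) L ≗ f₁ x ++ f₂ x
    labelled x (L₀ , con₀ , out₀) (L₁ , con₁ , out₁) (L₂ , con₂ , out₂) =
      L₀ ++ (L₁ ++ L₂) ,
      Fan.consistent con₀ out₀ (Both.consistent (lookup-++ˡ x x) (lookup-++ʳ x x) con₁ con₂) ,
      λ j → trans (Fan.output-++ L₀ (L₁ ++ L₂) j)
                  (trans (Both.output-++ L₁ L₂ j) (++-cong (Semantics.output N₁ L₁) (f₁ x) out₁ out₂ j))

  record Compiled {n} (a : Circuit n) : Set where
    field
      net        : Network n 1
      implements : Implements net (λ x _ → ⟦ a ⟧ x)
      attached   : Attached net

  compile : ∀ {n} (a : Circuit n) → Compiled a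
  compile (input i) = record { net = select i ; implements = select-implements i ; attached = select-attached i }
  compile (a ⊕ b) = record
    { net        = Serial.net both (single adder 1 0) both-attached
    ; implements = Serial.implements both (single adder 1 0) both-attached
                     (fork-implements (Compiled.implements A) (Compiled.implements B)) adder-implements
    ; attached   = Serial.attached both (single adder 1 0) both-attached (single-attached adder 1 0)
    }
    where
    A : Compiled a
    A = compile a
    B : Compiled b
    B = compile b
    both : Network _ 2
    both = fork (Compiled.net A) (Compiled.net B)
    both-attached : Attached both
    both-attached = fork-attached (Compiled.net A) (Compiled.net B) (Compiled.attached A) (Compiled.attached B)
  compile (topple d q q<2+d a) = record
    { net        = Serial.net (Compiled.net A) top (Compiled.attached A)
    ; implements = Serial.implements (Compiled.net A) top (Compiled.attached A) (Compiled.implements A) (toppler-implements d q q<2+d)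
    ; attached   = Serial.attached (Compiled.net A) top (Compiled.attached A) (single-attached (Toppler.gate d q q<2+d) 1 0)
    }
    where
    A : Compiled a
    A = compile a
    top : Network 1 1
    top = single (Toppler.gate d q q<2+d) 1 0

  compile? : ∀ {n} (a : Maybe (Circuit n)) → Σ (Network n 1) λ N → Implements N (λ x _ → ⟦ a ⟧? x)
  compile? {n} nothing = Parallel.net unattached (sinks n) ,
    implements-cong (Parallel.implements unattached (sinks n) unattached-implements (sinks-implements n)) (λ { x zero → refl })
  compile? (just a) = Compiled.net (compile a) , Compiled.implements (compile a)

  compile-all : ∀ {n k} (as : Fin k → Maybe (Circuit n)) → Σ (Network n k) λ N → Implements N (λ x j → ⟦ as j ⟧? x)
  compile-all {n} {zero}  as = sinks n , implements-cong (sinks-implements n) (λ _ ())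
  compile-all {n} {suc k} as = fork (proj₁ (compile? (as zero))) (proj₁ (compile-all (as ∘ suc))) ,
    implements-cong (fork-implements (proj₂ (compile? (as zero))) (proj₂ (compile-all (as ∘ suc))))
                    (λ { x zero → refl ; x (suc j) → refl })

open Circuits
open Processors
open Networks
open Composition
open Compilation

implements⇒emulates : ∀ {nA nB} {N : Network nA nB} {P : Processor nA nB} → Implements N (compute P) → Emulates N P
implements⇒emulates {N = N} I x with Implements.labelling I x
... | L , consistent , outputs with Semantics.sorted-halts N (Implements.sorted I) consistent
...   | C , run , halted , out = C , run , halted , λ b → trans (out b) (outputs b)

theorem1p3 : (nA nB : ℕ) (P : Processor nA nB) →
    IsAbelian P → AllReachable P → IsRecurrent P →
    Σ (Network nA nB) λ N → WellFormed N × Acyclic N × Emulates N P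
theorem1p3 nA nB P abelian _ recurrent =
  N , Implements.wellFormed I , Semantics.sorted⇒acyclic N (Implements.sorted I) , implements⇒emulates {P = P} I
  where
  open Processor P using (nQ)
  circuit : ∀ b → Σ (Maybe (Circuit nA)) λ a → ∀ x → ⟦ a ⟧? x ≡ compute P x b
  circuit b = circuit-representation (pred (nQ !)) _ (λ x → compute P x b)
    (compute-extensional P b) (compute-monotone P abelian b)
    (compute-periodic P abelian recurrent b) (compute-zero P b)
  compiled : Σ (Network nA nB) λ N → Implements N (λ x b → ⟦ proj₁ (circuit b) ⟧? x)
  compiled = compile-all (proj₁ ∘ circuit)
  N : Network nA nB
  N = proj₁ compiled
  I : Implements N (compute P)
  I = implements-cong (proj₂ compiled) (λ x b → proj₂ (circuit b) x)
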